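{- Let $q\ge 2$ be an integer. If $F$ is an unsatisfiable CNF consisting of $s$ clauses, each of width at most $w$ (i.e. containing at most $w$ literals), then $F$ reduces to $tr(F)$ (viewed as polynomials over $\mathbb{Z}_q$) in depth $O(1)$ and size $s\,2^{O(w)}$.
   Context: Direct translation: for a clause $C$ in variables $\vec x$, $tr(C)$ is defined by $tr(\emptyset)=1$, $tr(A\vee x)=tr(A)(1-x)$, $tr(A\vee\neg x)=tr(A)x$; for a CNF $F$, $tr(F)=\{tr(C): C\in F\}$. A $0/1$ assignment satisfies $C$ iff it is a root of $tr(C)$. Notation: $[S]^q$ is the set of $q$-element subsets of $S$; $E\perp F$ means $E\ne F$, $E\cap F\ne\emptyset$; $[N]=\{1,\dots,N\}$; $x_I=\prod_{i\in I}x_i$. Multilinearization $\bar f$ replaces each $\prod x_i^{\alpha_i}$ ($\alpha_i\ge1$) by $\prod x_i$. For multilinear $f=\sum_I a_Ix_I$ over $\mathbb{Z}_q$ ($a_I\in\{0,\dots,q-1\}$), $M_f=\{m_{c,I}: c\in[a_I]\}$ ($a_I$ formal copies of $x_I$). Formulas $\theta_E$, $E\in[M_f]^q$, form a $q$-partition of the satisfied monomials of $f$ if: every $\theta_E$ implies $\bigwedge_{k\in I}x_k$ for all $m_{c,I}\in E$; $\neg\theta_E\vee\neg\theta_F$ for all $E\perp F$; and for each $m_{c,I}\in M_f$, $\bigwedge_{k\in I}x_k\rightarrow\bigvee_{E\ni m_{c,I}}\theta_E$. Frege systems: sound, implicationally complete propositional systems (e.g. connectives $\neg,\bigvee$, axiom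 $A\vee\neg A$, weakening, cut, merging/unmerging rules); size of a derivation = number of symbols, depth = maximum formula depth. Reduction: a formula $\Gamma$ reduces to $\{f_1,\dots,f_k\}$ over $\mathbb{Z}_q$ in depth $d$ and size $T$ if for each $i$ there are formulas $\beta^i_E$, $E\in[M_{\bar f_i}]^q$, and a Frege derivation from $\Gamma$ of size $T$ and depth $d$ of the statements that for each $i$ the $\beta^i_E$ form a $q$-partition of the satisfied monomials of $\bar f_i$. -}

module Defs where

open import Data.Nat using (ℕ; zero; suc; _+_; _*_; _^_; _≤_; _⊔_; NonZero)
open import Data.Bool using (Bool; true; false; if_then_else_; not; _∨_; _∧_)
open import Data.Fin using (Fin)
open import Data.Fin.Subset using (Subset; ∣_∣; _∈_; _∩_; Nonempty; ⁅_⁆; ⊥) renaming (_∪_ to _∪ₛ_)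
open import Data.Fin.Subset.Properties using (_∈?_)
open import Data.Vec using (Vec; []; _∷_; replicate; zipWith; lookup)
import Data.Vec as V
open import Data.Vec.Properties using (≡-dec)
open import Data.List using (List; []; _∷_; _++_; map; concatMap; filter; length; sum; allFin; foldr)
import Data.List as L
open import Data.List.Relation.Unary.All using (All; []; _∷_)
open import Data.List.Relation.Unary.Any using (Any)
open import Data.List.Membership.Propositional using () renaming (_∈_ to _∈ₗ_)
open import Data.List.Relation.Binary.Subset.Propositional using () renaming (_⊆_ to _⊆ₗ_)
open import Data.Integer using (ℤ; +_; -_) renaming (_+_ to _+ℤ_)
open import Data.Integer.DivMod using (_%ℕ_)
open import Data.Product using (Σ; _×_; _,_; proj₁; proj₂; ∃)
open import Relation.Nullary using (¬_; does)
open import Relation.Nullary.Decidable using (_×-dec_)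
open import Data.Unit using (⊤)
open import Relation.Binary.PropositionalEquality using (_≡_; _≢_)
import Data.Bool as B

data Literal (n : ℕ) : Set where
  pos : Fin n → Literal n
  neg : Fin n → Literal n

Clause : ℕ → Set
Clause n = List (Literal n)

CNF : ℕ → Set
CNF n = List (Clause n)

Assignment : ℕ → Set
Assignment n = Fin n → Bool

litTrue : ∀ {n} → Assignment n → Literal n → Set
litTrue α (pos k) = α k ≡ true
litTrue α (neg k) = α k ≡ false

ClauseSat : ∀ {n} → Assignment n → Clause n → Set
ClauseSat α C = Any (litTrue α) C

Satisfies : ∀ {n} → Assignment n → CNF n → Set
Satisfies α F = All (ClauseSat α) F

Unsatisfiable : ∀ {n} → CNF n → Set
Unsatisfiable {n} F = (α : Assignment n) → ¬ Satisfies α F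

WidthAtMost : ∀ {n} → ℕ → CNF n → Set
WidthAtMost w F = All (λ C → length C ≤ w) F

Poly : ℕ → Set
Poly n = List (ℤ × Vec ℕ n)

unitExp : ∀ {n} → Fin n → Vec ℕ n
unitExp k = V.map (λ b → if b then 1 else 0) ⁅ k ⁆

mulVar : ∀ {n} → Fin n → Poly n → Poly n
mulVar k p = map (λ t → proj₁ t , zipWith _+_ (proj₂ t) (unitExp k)) p

negP : ∀ {n} → Poly n → Poly n
negP p = map (λ t → - proj₁ t , proj₂ t) p

-- direct translation:  tr(∅) = 1,  tr(A ∨ x) = tr(A)(1 - x),  tr(A ∨ ¬x) = tr(A) x.
-- A clause is a list of literals; the literal at the head is the last one added.
tr : ∀ {n} → Clause n → Poly n
tr [] = (+ 1 , replicate _ 0) ∷ []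
tr (pos k ∷ A) = tr A ++ negP (mulVar k (tr A))
tr (neg k ∷ A) = mulVar k (tr A)

trCNF : ∀ {n} → CNF n → List (Poly n)
trCNF F = map tr F

-- multilinearization of a monomial: every exponent ≥ 1 becomes 1,
-- so a multilinear monomial x_I is given by the set I ⊆ [n]
mlMon : ∀ {n} → Vec ℕ n → Subset n
mlMon = V.map (λ { zero → false ; (suc _) → true })

subsets : (n : ℕ) → List (Subset n)
subsets zero = [] ∷ []
subsets (suc n) = map (false ∷_) (subsets n) ++ map (true ∷_) (subsets n)

-- coefficient a_I ∈ {0,…,q-1} of x_I in the multilinearization of p, over ℤ_q
coeff : ∀ {n} (q : ℕ) .{{_ : NonZero q}} → Poly n → Subset n → ℕ
coeff {n} q p I =
  foldr _+ℤ_ (+ 0) (map proj₁ (filter (λ t → ≡-dec B._≟_ (mlMon (proj₂ t)) I) p)) %ℕ q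

-- M_f: the list of formal copies m_{c,I}, c ∈ [a_I], of the monomials of the
-- multilinearization f̄ over ℤ_q; the element in position j is a copy of x_{I_j}
Mf : ∀ {n} (q : ℕ) .{{_ : NonZero q}} → Poly n → List (Subset n)
Mf {n} q p = concatMap (λ I → L.replicate (coeff q p I) I) (subsets n)

-- |M_f|; elements of M_f are indexed by Fin (sizeM q p), so E ⊆ M_f is a Subset (sizeM q p)
sizeM : ∀ {n} (q : ℕ) .{{_ : NonZero q}} → Poly n → ℕ
sizeM q p = length (Mf q p)

monOf : ∀ {n} (q : ℕ) .{{_ : NonZero q}} (p : Poly n) → Fin (sizeM q p) → Subset n
monOf q p j = L.lookup (Mf q p) j

varsOf : ∀ {n} → Subset n → List (Fin n)
varsOf {n} I = filter (λ k → k ∈? I) (allFin n)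

data Form (n : ℕ) : Set where
  var : Fin n → Form n
  ¬f  : Form n → Form n
  ⋁   : List (Form n) → Form n

mutual
  size : ∀ {n} → Form n → ℕ
  size (var _) = 1
  size (¬f A) = suc (size A)
  size (⋁ Γ) = suc (sizes Γ)

  sizes : ∀ {n} → List (Form n) → ℕ
  sizes [] = 0
  sizes (A ∷ Γ) = size A + sizes Γ

mutual
  depth : ∀ {n} → Form n → ℕ
  depth (var _) = 0
  depth (¬f A) = suc (depth A)
  depth (⋁ Γ) = suc (depths Γ)

  depths : ∀ {n} → List (Form n) → ℕ
  depths [] = 0
  depths (A ∷ Γ) = depth A ⊔ depths Γ

_⇒_ : ∀ {n} → Form n → Form n → Form n
A ⇒ B = ⋁ (¬f A ∷ B ∷ [])

⋀ : ∀ {n} → List (Form n) → Form n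
⋀ Γ = ¬f (⋁ (map ¬f Γ))

conjVars : ∀ {n} → Subset n → Form n
conjVars I = ⋀ (map var (varsOf I))

litForm : ∀ {n} → Literal n → Form n
litForm (pos k) = var k
litForm (neg k) = ¬f (var k)

clauseForm : ∀ {n} → Clause n → Form n
clauseForm C = ⋁ (map litForm C)

-- A derivation from hypotheses H is a list of lines, NEWEST FIRST; every
-- line is a hypothesis, an axiom, or follows by a rule from earlier lines.

data Step {n : ℕ} (H : List (Form n)) (ls : List (Form n)) : Form n → Set where
  hyp     : ∀ {A} → A ∈ₗ H → Step H ls A
  axiom   : ∀ A → Step H ls (⋁ (A ∷ ¬f A ∷ []))
  weak    : ∀ {A} B → A ∈ₗ ls → Step H ls (⋁ (A ∷ B ∷ []))
  cut     : ∀ {A B C} → ⋁ (A ∷ B ∷ []) ∈ₗ ls → ⋁ (¬f A ∷ C ∷ []) ∈ₗ ls →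
            Step H ls (⋁ (B ∷ C ∷ []))
  merge   : ∀ {Γ Δ Γ'} → ⋁ (Γ ++ ⋁ Δ ∷ Γ') ∈ₗ ls → Step H ls (⋁ (Γ ++ Δ ++ Γ'))
  unmerge : ∀ {Γ Δ Γ'} → ⋁ (Γ ++ Δ ++ Γ') ∈ₗ ls → Step H ls (⋁ (Γ ++ ⋁ Δ ∷ Γ'))
  reorder : ∀ {Γ Δ} → ⋁ Γ ∈ₗ ls → Γ ⊆ₗ Δ → Δ ⊆ₗ Γ → Step H ls (⋁ Δ)
  single  : ∀ {A} → ⋁ (A ∷ []) ∈ₗ ls → Step H ls A

data Derivation {n : ℕ} (H : List (Form n)) : List (Form n) → Set where
  []  : Derivation H []
  _∷_ : ∀ {A ls} → Step H ls A → Derivation H ls → Derivation H (A ∷ ls)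

-- q-partitions of the satisfied monomials of the multilinearization of p,
-- by formulas θ_E (E ranging over the q-element subsets of M_f; values of θ
-- on other subsets are irrelevant), as a list of formulas that must be derived.

qSetsContaining : ∀ {n} (q : ℕ) .{{_ : NonZero q}} (p : Poly n) →
                  Fin (sizeM q p) → List (Subset (sizeM q p))
qSetsContaining q p j =
  filter (λ E → (∣ E ∣ Data.Nat.≟ q) ×-dec (j ∈? E)) (subsets (sizeM q p))

PartitionDerived : ∀ {n} (q : ℕ) .{{_ : NonZero q}} (p : Poly n) →
                   (Subset (sizeM q p) → Form n) → List (Form n) → Set
PartitionDerived q p θ ls =
  (∀ (E : Subset (sizeM q p)) → ∣ E ∣ ≡ q → ∀ j → j ∈ E →
     (θ E ⇒ conjVars (monOf q p j)) ∈ₗ ls)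
  × (∀ (E F : Subset (sizeM q p)) → ∣ E ∣ ≡ q → ∣ F ∣ ≡ q → E ≢ F → Nonempty (E ∩ F) →
     ⋁ (¬f (θ E) ∷ ¬f (θ F) ∷ []) ∈ₗ ls)
  × (∀ j → (conjVars (monOf q p j) ⇒ ⋁ (map θ (qSetsContaining q p j))) ∈ₗ ls)

ReducesTo : ∀ {n} (H : List (Form n)) (fs : List (Poly n)) (q : ℕ) .{{_ : NonZero q}} (d T : ℕ) → Set
ReducesTo {n} H fs q d T =
  Σ (All (λ p → Subset (sizeM q p) → Form n) fs) λ β →
  Σ (List (Form n)) λ ls →
    Derivation H ls
    × sizes ls ≤ T
    × All (λ A → depth A ≤ d) ls
    × AllPartitions β ls
  where
    AllPartitions : ∀ {gs} → All (λ p → Subset (sizeM q p) → Form n) gs → List (Form n) → Set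
    AllPartitions {[]} _ _ = ⊤
    AllPartitions {g ∷ gs} (θ ∷ θs) ls = PartitionDerived q g θ ls × AllPartitions θs ls

{-# OPTIONS --safe #-}
-- Fix a clause C with at most w variables and let f = tr C. An assignment satisfying C is a
-- root of f, so, counted with their multiplicities a_I mod q, the monomials of f̄ it satisfies
-- number Σ a_I ≡ f(α) ≡ 0 (mod q). Listing them in order and cutting the list into groups of q
-- gives a q-partition that depends only on the values of the variables of C; θ_E is then the
-- disjunction of the (at most 2^w) assignments to these variables under which E is a group.
-- Every required statement about the θ_E mentions only the variables of C and follows from C,
-- so the Frege system derives it from C by a case split over all assignments to those variables,
-- in size polynomial in 2^w for fixed q. Summing over the clauses gives size s·2^(O(w)) and depth 10.
module Submission where

open import Defs
open import Data.Nat using (ℕ; NonZero; _≤_)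
open import Data.Fin using (Fin)
open import Data.List using (List; length)
open import Data.List.Membership.Propositional using () renaming (_∈_ to _∈ₗ_)

module Semantics where

  open import Data.Nat using (suc; _+_; _*_; _≤_; _⊔_; z≤n; s≤s)
  open import Data.Nat.Properties
    using (+-assoc; +-mono-≤; +-monoʳ-≤; ⊔-assoc; ⊔-lub; ⊔-monoˡ-≤; ⊔-monoʳ-≤; m≤m⊔n; m≤n⊔m; m≤m+n; m≤n+m; n≤1+n; ≤-trans)
  open import Data.Bool using (Bool; true; false; not; _∨_)
  open import Data.Fin using (Fin)
  open import Data.List using (List; []; _∷_; _++_; map; length)
  open import Data.List.Relation.Unary.All as All using (All; []; _∷_)
  open import Data.List.Relation.Unary.Any using (here; there)
  open import Data.List.Membership.Propositional using (_∈_)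
  open import Data.Product using (∃; _×_; _,_)
  open import Data.Unit using (⊤)
  open import Data.Empty using (⊥)
  open import Relation.Nullary using (contradiction)
  open import Relation.Binary.PropositionalEquality using (_≡_; refl; sym; trans; cong)

  mutual
    eval : ∀ {n} → Assignment n → Form n → Bool
    eval α (var k) = α k
    eval α (¬f A) = not (eval α A)
    eval α (⋁ Γ) = evalAny α Γ

    evalAny : ∀ {n} → Assignment n → List (Form n) → Bool
    evalAny α [] = false
    evalAny α (A ∷ Γ) = eval α A ∨ evalAny α Γ

  mutual
    UsesOnly : ∀ {n} → List (Fin n) → Form n → Set
    UsesOnly V (var k) = k ∈ V
    UsesOnly V (¬f A) = UsesOnly V A
    UsesOnly V (⋁ Γ) = AllUseOnly V Γ

    AllUseOnly : ∀ {n} → List (Fin n) → List (Form n) → Set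
    AllUseOnly V [] = ⊤
    AllUseOnly V (A ∷ Γ) = UsesOnly V A × AllUseOnly V Γ

  allUseOnly : ∀ {n} {V : List (Fin n)} Γ → (∀ {B} → B ∈ Γ → UsesOnly V B) → AllUseOnly V Γ
  allUseOnly [] _ = _
  allUseOnly (A ∷ Γ) h = h (here refl) , allUseOnly Γ (λ B∈Γ → h (there B∈Γ))

  evalAny-true⁻ : ∀ {n} (α : Assignment n) Γ → evalAny α Γ ≡ true → ∃ λ B → B ∈ Γ × eval α B ≡ true
  evalAny-true⁻ α (A ∷ Γ) e with eval α A in eA
  ... | true = A , here refl , eA
  ... | false with evalAny-true⁻ α Γ e
  ...   | B , B∈Γ , eB = B , there B∈Γ , eB

  evalAny-true⁺ : ∀ {n} (α : Assignment n) {Γ B} → B ∈ Γ → eval α B ≡ true → evalAny α Γ ≡ true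
  evalAny-true⁺ α (here refl) e rewrite e = refl
  evalAny-true⁺ α {A ∷ _} (there B∈Γ) e with eval α A
  ... | true = refl
  ... | false = evalAny-true⁺ α B∈Γ e

  evalAny-false⁻ : ∀ {n} (α : Assignment n) Γ → evalAny α Γ ≡ false → All (λ B → eval α B ≡ false) Γ
  evalAny-false⁻ α [] _ = []
  evalAny-false⁻ α (A ∷ Γ) e with eval α A in eA
  ... | false = eA ∷ evalAny-false⁻ α Γ e

  eval-⋀⁺ : ∀ {n} (α : Assignment n) Γ → (∀ {B} → B ∈ Γ → eval α B ≡ true) → eval α (⋀ Γ) ≡ true
  eval-⋀⁺ α [] h = refl
  eval-⋀⁺ α (A ∷ Γ) h rewrite h (here refl) = eval-⋀⁺ α Γ (λ B∈Γ → h (there B∈Γ))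

  eval-⋀⁻ : ∀ {n} (α : Assignment n) Γ → eval α (⋀ Γ) ≡ true → ∀ {B} → B ∈ Γ → eval α B ≡ true
  eval-⋀⁻ α (A ∷ Γ) e B∈Γ with eval α A in eA
  eval-⋀⁻ α (A ∷ Γ) e (here refl) | true = eA
  eval-⋀⁻ α (A ∷ Γ) e (there B∈Γ) | true = eval-⋀⁻ α Γ e B∈Γ

  eval-¬∨¬ : ∀ {n} (α : Assignment n) A B → (eval α A ≡ true → eval α B ≡ true → ⊥) →
             eval α (⋁ (¬f A ∷ ¬f B ∷ [])) ≡ true
  eval-¬∨¬ α A B not-both with eval α A | eval α B
  ... | true | true = contradiction refl (not-both refl)
  ... | true | false = refl
  ... | false | _ = refl

  eval-⇒ : ∀ {n} (α : Assignment n) A B → (eval α A ≡ true → eval α B ≡ true) → eval α (A ⇒ B) ≡ true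
  eval-⇒ α A B f with eval α A
  ... | true rewrite f refl = refl
  ... | false = refl

  signed : ∀ {n} → Bool → Form n → Form n
  signed true A = A
  signed false A = ¬f A

  sizes-++ : ∀ {n} (Γ Δ : List (Form n)) → sizes (Γ ++ Δ) ≡ sizes Γ + sizes Δ
  sizes-++ [] Δ = refl
  sizes-++ (A ∷ Γ) Δ = trans (cong (size A +_) (sizes-++ Γ Δ)) (sym (+-assoc (size A) _ _))

  size≤sizes : ∀ {n} (Γ : List (Form n)) → All (λ B → size B ≤ sizes Γ) Γ
  size≤sizes [] = []
  size≤sizes (A ∷ Γ) = m≤m+n _ _ ∷ All.map (λ p → ≤-trans p (m≤n+m _ _)) (size≤sizes Γ)

  sizes≤length* : ∀ {n K} (Γ : List (Form n)) → All (λ B → size B ≤ K) Γ → sizes Γ ≤ length Γ * K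
  sizes≤length* [] _ = z≤n
  sizes≤length* (A ∷ Γ) (A≤ ∷ Γ≤) = +-mono-≤ A≤ (sizes≤length* Γ Γ≤)

  sizes-map≤ : ∀ {n} {A : Set} (f : A → Form n) (xs : List A) {b} →
               (∀ {x} → x ∈ xs → size (f x) ≤ b) → sizes (map f xs) ≤ length xs * b
  sizes-map≤ f [] h = z≤n
  sizes-map≤ f (x ∷ xs) h = +-mono-≤ (h (here refl)) (sizes-map≤ f xs (λ x∈xs → h (there x∈xs)))

  depths-lub : ∀ {n d} {Γ : List (Form n)} → All (λ B → depth B ≤ d) Γ → depths Γ ≤ d
  depths-lub [] = z≤n
  depths-lub (p ∷ ps) = ⊔-lub p (depths-lub ps)

  depths-++ : ∀ {n} (Γ Δ : List (Form n)) → depths (Γ ++ Δ) ≡ depths Γ ⊔ depths Δ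
  depths-++ [] Δ = refl
  depths-++ (A ∷ Γ) Δ = trans (cong (depth A ⊔_) (depths-++ Γ Δ)) (sym (⊔-assoc (depth A) _ _))

  merge-size : ∀ {n} (Γ Δ Γ' : List (Form n)) → size (⋁ (Γ ++ Δ ++ Γ')) ≤ size (⋁ (Γ ++ ⋁ Δ ∷ Γ'))
  merge-size Γ Δ Γ' rewrite sizes-++ Γ (Δ ++ Γ') | sizes-++ Γ (⋁ Δ ∷ Γ') | sizes-++ Δ Γ' =
    s≤s (+-monoʳ-≤ (sizes Γ) (n≤1+n _))

  merge-depth : ∀ {n} (Γ Δ Γ' : List (Form n)) → depth (⋁ (Γ ++ Δ ++ Γ')) ≤ depth (⋁ (Γ ++ ⋁ Δ ∷ Γ'))
  merge-depth Γ Δ Γ' rewrite depths-++ Γ (Δ ++ Γ') | depths-++ Γ (⋁ Δ ∷ Γ') | depths-++ Δ Γ' =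
    s≤s (⊔-monoʳ-≤ (depths Γ) (⊔-monoˡ-≤ (depths Γ') (n≤1+n _)))

  depth-⋁ : ∀ {n d} {Γ : List (Form n)} → All (λ B → depth B ≤ d) Γ → depth (⋁ Γ) ≤ suc d
  depth-⋁ ps = s≤s (depths-lub ps)

  depth≤depths : ∀ {n} (Γ : List (Form n)) → All (λ B → depth B ≤ depths Γ) Γ
  depth≤depths [] = []
  depth≤depths (A ∷ Γ) = m≤m⊔n _ _ ∷ All.map (λ p → ≤-trans p (m≤n⊔m _ _)) (depth≤depths Γ)

  depths-map≤ : ∀ {n} {A : Set} (f : A → Form n) (xs : List A) {d} →
                (∀ {x} → x ∈ xs → depth (f x) ≤ d) → All (λ B → depth B ≤ d) (map f xs)
  depths-map≤ f [] h = []
  depths-map≤ f (x ∷ xs) h = h (here refl) ∷ depths-map≤ f xs (λ x∈xs → h (there x∈xs))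

module Derivations {n : ℕ} (H : List (Form n)) where

  open import Data.Nat using (ℕ; suc; _+_; _*_; _≤_; z≤n; s≤s)
  open import Data.Nat.Properties using (≤-refl; ≤-trans; +-mono-≤; n≤1+n)
  open import Data.List using (List; []; _∷_; _++_; length)
  open import Data.List.Properties using (length-++)
  open import Data.List.Relation.Unary.All as All using (All; []; _∷_)
  open import Data.List.Relation.Unary.All.Properties using (++⁺)
  open import Data.List.Relation.Unary.Any using (here; there)
  open import Data.List.Membership.Propositional using (_∈_)
  open import Data.List.Membership.Propositional.Properties using (∈-++⁺ˡ; ∈-++⁺ʳ)
  open import Data.List.Relation.Binary.Subset.Propositional using (_⊆_)
  open import Data.Product using (∃; _×_; _,_)
  open import Relation.Binary.PropositionalEquality using (refl; sym; subst)
  open Semantics using (merge-size; merge-depth; size≤sizes; depth≤depths)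

  Step-mono : ∀ {ls ls' A} → ls ⊆ ls' → Step H ls A → Step H ls' A
  Step-mono s (hyp h) = hyp h
  Step-mono s (axiom A) = axiom A
  Step-mono s (weak B p) = weak B (s p)
  Step-mono s (cut p p') = cut (s p) (s p')
  Step-mono s (merge p) = merge (s p)
  Step-mono s (unmerge p) = unmerge (s p)
  Step-mono s (reorder p Γ⊆Δ Δ⊆Γ) = reorder (s p) Γ⊆Δ Δ⊆Γ
  Step-mono s (single p) = single (s p)

  _++ᴰ_ : ∀ {ls ls'} → Derivation H ls → Derivation H ls' → Derivation H (ls ++ ls')
  [] ++ᴰ d' = d'
  (s ∷ d) ++ᴰ d' = Step-mono ∈-++⁺ˡ s ∷ (d ++ᴰ d')

  record Proof (N K D : ℕ) (A : Form n) : Set where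
    constructor proof
    field
      lines : List (Form n)
      derivation : Derivation H lines
      concludes : A ∈ lines
      length≤ : length lines ≤ N
      size≤ : All (λ B → size B ≤ K) lines
      depth≤ : All (λ B → depth B ≤ D) lines

  relax : ∀ {N N' K D A} → N ≤ N' → Proof N K D A → Proof N' K D A
  relax N≤N' (proof ls d A∈ len sz dp) = proof ls d A∈ (≤-trans len N≤N') sz dp

  record Fits (K D : ℕ) (B : Form n) : Set where
    constructor _,_
    field
      size-fits : size B ≤ K
      depth-fits : depth B ≤ D

  conclusion-fits : ∀ {N K D A} → Proof N K D A → Fits K D A
  conclusion-fits (proof _ _ A∈ _ sz dp) = All.lookup sz A∈ , All.lookup dp A∈

  component-fits : ∀ {K D B Γ} → B ∈ Γ → Fits K D (⋁ Γ) → Fits K D B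
  component-fits {Γ = Γ} B∈Γ (s , d) =
    ≤-trans (≤-trans (All.lookup (size≤sizes Γ) B∈Γ) (n≤1+n _)) s ,
    ≤-trans (≤-trans (All.lookup (depth≤depths Γ) B∈Γ) (n≤1+n _)) d

  infer₀ : ∀ {K D B} → (∀ {ls} → Step H ls B) → Fits K D B → Proof 1 K D B
  infer₀ st (sB , dB) = proof (_ ∷ []) (st ∷ []) (here refl) ≤-refl (sB ∷ []) (dB ∷ [])

  infer₁ : ∀ {N K D A B} → (∀ {ls} → A ∈ ls → Step H ls B) → Fits K D B → Proof N K D A → Proof (suc N) K D B
  infer₁ st (sB , dB) (proof ls d A∈ len sz dp) =
    proof (_ ∷ ls) (st A∈ ∷ d) (here refl) (s≤s len) (sB ∷ sz) (dB ∷ dp)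

  infer₂ : ∀ {N M K D A A' B} → (∀ {ls} → A ∈ ls → A' ∈ ls → Step H ls B) →
           Fits K D B → Proof N K D A → Proof M K D A' → Proof (suc (N + M)) K D B
  infer₂ {N} {M} st (sB , dB) (proof ls d A∈ len sz dp) (proof ls' d' A'∈ len' sz' dp') =
    proof (_ ∷ ls ++ ls') (st (∈-++⁺ˡ A∈) (∈-++⁺ʳ ls A'∈) ∷ (d ++ᴰ d')) (here refl)
      (s≤s (subst (_≤ N + M) (sym (length-++ ls)) (+-mono-≤ len len')))
      (sB ∷ ++⁺ sz sz') (dB ∷ ++⁺ dp dp')

  hypᴾ : ∀ {K D A} → A ∈ H → Fits K D A → Proof 1 K D A
  hypᴾ A∈H = infer₀ (hyp A∈H)

  axiomᴾ : ∀ {K D} A → Fits K D (⋁ (A ∷ ¬f A ∷ [])) → Proof 1 K D (⋁ (A ∷ ¬f A ∷ []))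
  axiomᴾ A = infer₀ (axiom A)

  weakᴾ : ∀ {N K D A} B → Fits K D (⋁ (A ∷ B ∷ [])) → Proof N K D A → Proof (suc N) K D (⋁ (A ∷ B ∷ []))
  weakᴾ B = infer₁ (weak B)

  cutᴾ : ∀ {N M K D A B C} → Fits K D (⋁ (B ∷ C ∷ [])) →
         Proof N K D (⋁ (A ∷ B ∷ [])) → Proof M K D (⋁ (¬f A ∷ C ∷ [])) → Proof (suc (N + M)) K D (⋁ (B ∷ C ∷ []))
  cutᴾ = infer₂ cut

  unmergeᴾ : ∀ {N K D} Γ Δ Γ' → Fits K D (⋁ (Γ ++ ⋁ Δ ∷ Γ')) →
             Proof N K D (⋁ (Γ ++ Δ ++ Γ')) → Proof (suc N) K D (⋁ (Γ ++ ⋁ Δ ∷ Γ'))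
  unmergeᴾ Γ Δ Γ' = infer₁ (unmerge {Γ = Γ} {Δ} {Γ'})

  reorderᴾ : ∀ {N K D Γ Δ} → Γ ⊆ Δ → Δ ⊆ Γ → Fits K D (⋁ Δ) → Proof N K D (⋁ Γ) → Proof (suc N) K D (⋁ Δ)
  reorderᴾ Γ⊆Δ Δ⊆Γ = infer₁ (λ p → reorder p Γ⊆Δ Δ⊆Γ)

  -- Merging and extracting A from ⋁ (A ∷ []) only shrink a line, so they need no side condition.
  merge-fits : ∀ {K D} Γ Δ Γ' → Fits K D (⋁ (Γ ++ ⋁ Δ ∷ Γ')) → Fits K D (⋁ (Γ ++ Δ ++ Γ'))
  merge-fits Γ Δ Γ' (s , d) = ≤-trans (merge-size Γ Δ Γ') s , ≤-trans (merge-depth Γ Δ Γ') d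

  mergeᴾ : ∀ {N K D} Γ Δ Γ' → Proof N K D (⋁ (Γ ++ ⋁ Δ ∷ Γ')) → Proof (suc N) K D (⋁ (Γ ++ Δ ++ Γ'))
  mergeᴾ Γ Δ Γ' p = infer₁ (merge {Γ = Γ} {Δ} {Γ'}) (merge-fits Γ Δ Γ' (conclusion-fits p)) p

  singleᴾ : ∀ {N K D A} → Proof N K D (⋁ (A ∷ [])) → Proof (suc N) K D A
  singleᴾ {A = A} p = infer₁ single (component-fits {Γ = A ∷ []} (here refl) (conclusion-fits p)) p

  proveAll : ∀ {N K D} (Φ : List (Form n)) → (∀ {φ} → φ ∈ Φ → Proof N K D φ) →
             ∃ λ ls → Derivation H ls × (∀ {φ} → φ ∈ Φ → φ ∈ ls) × length ls ≤ length Φ * N ×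
                      All (λ B → size B ≤ K) ls × All (λ B → depth B ≤ D) ls
  proveAll [] f = [] , [] , (λ ()) , z≤n , [] , []
  proveAll {N} (φ ∷ Φ) f with f (here refl) | proveAll Φ (λ φ∈Φ → f (there φ∈Φ))
  ... | proof l d φ∈l len sz dp | ls , ds , Φ⊆ls , len' , sz' , dp' =
    l ++ ls , d ++ᴰ ds ,
    (λ { (here refl) → ∈-++⁺ˡ φ∈l ; (there φ∈Φ) → ∈-++⁺ʳ l (Φ⊆ls φ∈Φ) }) ,
    subst (_≤ N + length Φ * N) (sym (length-++ l)) (+-mono-≤ len len') ,
    ++⁺ sz sz' , ++⁺ dp dp'

module Contexts {n : ℕ} where

  open import Data.Bool using (Bool; true; false; if_then_else_)
  open import Data.Fin using (Fin) renaming (_≟_ to _≟ᶠ_)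
  open import Data.List using (List; []; _∷_; _++_; map)
  open import Data.List.Relation.Unary.Any using (here; there)
  open import Data.List.Membership.Propositional using (_∈_)
  open import Data.List.Membership.Propositional.Properties using (∈-++⁺ˡ; ∈-++⁺ʳ; ∈-++⁻; ∈-map⁺; ∈-map⁻)
  open import Data.Product using (_×_; _,_; proj₁)
  open import Data.Sum using (inj₁; inj₂)
  open import Relation.Nullary using (yes; no; does; contradiction)
  open import Relation.Binary.PropositionalEquality using (_≡_; refl; cong)
  open Semantics

  -- A partial assignment; when a variable is listed twice, the first entry counts.
  Context : Set
  Context = List (Fin n × Bool)

  assignmentOf : Context → Assignment n
  assignmentOf [] k = false
  assignmentOf ((v , b) ∷ σ) k = if does (k ≟ᶠ v) then b else assignmentOf σ k

  falseLit trueLit : Fin n × Bool → Form n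
  falseLit (v , b) = if b then ¬f (var v) else var v
  trueLit (v , b) = if b then var v else ¬f (var v)

  falseLits : Context → List (Form n)
  falseLits = map falseLit

  conjLits : Context → Form n
  conjLits σ = ⋀ (map trueLit σ)

  falseLits-covers : ∀ σ {k} → k ∈ map proj₁ σ → falseLit (k , assignmentOf σ k) ∈ falseLits σ
  falseLits-covers ((v , b) ∷ σ) {k} k∈ with k ≟ᶠ v | k∈
  ... | yes refl | _ = here refl
  ... | no k≢v | here k≡v = contradiction k≡v k≢v
  ... | no _ | there k∈σ = there (falseLits-covers σ k∈σ)

  contexts : List (Fin n) → List Context
  contexts [] = [] ∷ []
  contexts (v ∷ W) = map ((v , true) ∷_) (contexts W) ++ map ((v , false) ∷_) (contexts W)

  contexts-domain : ∀ W {σ} → σ ∈ contexts W → map proj₁ σ ≡ W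
  contexts-domain [] (here refl) = refl
  contexts-domain (v ∷ W) σ∈ with ∈-++⁻ (map ((v , true) ∷_) (contexts W)) σ∈
  ... | inj₁ σ∈ᵗ with ∈-map⁻ _ σ∈ᵗ
  ...   | σ' , σ'∈ , refl = cong (v ∷_) (contexts-domain W σ'∈)
  contexts-domain (v ∷ W) σ∈ | inj₂ σ∈ᶠ with ∈-map⁻ _ σ∈ᶠ
  ...   | σ' , σ'∈ , refl = cong (v ∷_) (contexts-domain W σ'∈)

  restrict : Assignment n → List (Fin n) → Context
  restrict α = map (λ v → v , α v)

  restrict∈contexts : ∀ α W → restrict α W ∈ contexts W
  restrict∈contexts α [] = here refl
  restrict∈contexts α (v ∷ W) with α v
  ... | true = ∈-++⁺ˡ (∈-map⁺ _ (restrict∈contexts α W))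
  ... | false = ∈-++⁺ʳ (map ((v , true) ∷_) (contexts W)) (∈-map⁺ _ (restrict∈contexts α W))

  eval-trueLit : ∀ (α : Assignment n) v b → eval α (trueLit (v , b)) ≡ true → α v ≡ b
  eval-trueLit α v true αv = αv
  eval-trueLit α v false ¬αv with α v
  ... | false = refl

  restrict-satisfies : ∀ α W → eval α (conjLits (restrict α W)) ≡ true
  restrict-satisfies α W = eval-⋀⁺ α (map trueLit (restrict α W)) true-lit
    where
    true-lit : ∀ {B} → B ∈ map trueLit (restrict α W) → eval α B ≡ true
    true-lit B∈ with ∈-map⁻ _ B∈
    ... | x , x∈ , refl with ∈-map⁻ _ x∈
    ...   | v , _ , refl with α v in αv
    ...     | true = αv
    ...     | false rewrite αv = refl

  conjLits-agrees : ∀ α σ → eval α (conjLits σ) ≡ true → ∀ {k} → k ∈ map proj₁ σ → α k ≡ assignmentOf σ k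
  conjLits-agrees α σ ασ {k} = agree σ (eval-⋀⁻ α (map trueLit σ) ασ)
    where
    agree : ∀ σ → (∀ {B} → B ∈ map trueLit σ → eval α B ≡ true) → k ∈ map proj₁ σ → α k ≡ assignmentOf σ k
    agree ((v , b) ∷ σ) true-lits k∈ with k ≟ᶠ v | k∈
    ... | yes refl | _ = eval-trueLit α v b (true-lits (here refl))
    ... | no k≢v | here k≡v = contradiction k≡v k≢v
    ... | no _ | there k∈σ = agree σ (λ B∈ → true-lits (there B∈)) k∈σ

module Completeness {n : ℕ} (H : List (Form n)) (V : List (Fin n)) (Z d₀ : ℕ) where

  open import Data.Nat using (suc; _+_; _*_; _^_; _≤_; _⊔_; _≤ᵇ_; z≤n; s≤s)
  open import Data.Nat.Properties
  open import Data.Nat.Tactic.RingSolver using (solve-∀)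
  open import Data.Bool using (Bool; true; false; T; _∧_)
  open import Data.Bool.Properties using (T-∧)
  open import Data.List using ([]; _∷_; _++_; map; length)
  open import Data.List.Properties using (++-identityʳ)
  open import Data.List.Relation.Unary.All as All using (All; []; _∷_)
  open import Data.List.Relation.Unary.Any using (here; there)
  open import Data.List.Membership.Propositional using (_∈_)
  open import Data.List.Membership.Propositional.Properties using (∈-++⁺ˡ; ∈-++⁺ʳ; ∈-++⁻)
  open import Data.List.Relation.Binary.Subset.Propositional using (_⊆_)
  open import Data.List.Relation.Binary.Subset.Propositional.Properties
    using (⊆-refl; ⊆-reflexive; ⊆-trans; ∷⁺ʳ; xs⊆xs++ys; xs⊆ys++xs) renaming (++⁺ʳ to ++⁺ʳ-⊆)
  open import Data.Product using (∃; _×_; _,_; proj₁)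
  open import Data.Unit using (tt) -- the instance discharging the closed side conditions of fits
  open import Data.Sum using (inj₁; inj₂)
  open import Function using (Equivalence)
  open import Relation.Binary.PropositionalEquality

  open Semantics
  open Derivations H
  open Contexts

  S : ℕ
  S = 2 * length V

  -- Z bounds the formulas to be decided and S the literals falsified by an assignment to V.
  -- Size estimates a·Z + b·S + c with numeral coefficients, compared coefficientwise,
  -- turn every size side condition of the derivations below into a closed check.
  record Lin : Set where
    constructor ⟨_,_,_⟩
    field
      zc sc cc : ℕ

  ⟦_⟧ : Lin → ℕ
  ⟦ ⟨ a , b , c ⟩ ⟧ = a * Z + b * S + c

  _⊕_ : Lin → Lin → Lin
  ⟨ a , b , c ⟩ ⊕ ⟨ a' , b' , c' ⟩ = ⟨ a + a' , b + b' , c + c' ⟩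

  _⊑ᵇ_ : Lin → Lin → Bool
  ⟨ a , b , c ⟩ ⊑ᵇ ⟨ a' , b' , c' ⟩ = (a ≤ᵇ a') ∧ (b ≤ᵇ b') ∧ (c ≤ᵇ c')

  ⟦⟧-⊕ : ∀ l l' → ⟦ l ⊕ l' ⟧ ≡ ⟦ l ⟧ + ⟦ l' ⟧
  ⟦⟧-⊕ ⟨ a , b , c ⟩ ⟨ a' , b' , c' ⟩ = linear a b c a' b' c' Z S
    where
    linear : ∀ a b c a' b' c' z s →
             (a + a') * z + (b + b') * s + (c + c') ≡ (a * z + b * s + c) + (a' * z + b' * s + c')
    linear = solve-∀

  ⟦⟧-mono : ∀ l l' → T (l ⊑ᵇ l') → ⟦ l ⟧ ≤ ⟦ l' ⟧
  ⟦⟧-mono ⟨ a , b , c ⟩ ⟨ a' , b' , c' ⟩ t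
    with a≤ , t' ← Equivalence.to T-∧ t
    with b≤ , c≤ ← Equivalence.to T-∧ t' =
    +-mono-≤ (+-mono-≤ (*-monoˡ-≤ Z (≤ᵇ⇒≤ a a' a≤)) (*-monoˡ-≤ S (≤ᵇ⇒≤ b b' b≤))) (≤ᵇ⇒≤ c c' c≤)

  𝟘 𝟙 𝕫 𝕤 : Lin
  𝟘 = ⟨ 0 , 0 , 0 ⟩
  𝟙 = ⟨ 0 , 0 , 1 ⟩
  𝕫 = ⟨ 1 , 0 , 0 ⟩
  𝕤 = ⟨ 0 , 1 , 0 ⟩

  ⟦𝕫⟧ : ⟦ 𝕫 ⟧ ≡ Z
  ⟦𝕫⟧ = unit Z S
    where
    unit : ∀ z s → 1 * z + 0 * s + 0 ≡ z
    unit = solve-∀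

  ⟦𝕤⟧ : ⟦ 𝕤 ⟧ ≡ S
  ⟦𝕤⟧ = unit Z S
    where
    unit : ∀ z s → 0 * z + 1 * s + 0 ≡ s
    unit = solve-∀

  K Dp : ℕ
  K = ⟦ ⟨ 5 , 3 , 20 ⟩ ⟧
  Dp = d₀ + 3

  Line : ℕ → Form n → Set
  Line N = Proof N K Dp

  record Within (l : Lin) (k : ℕ) (B : Form n) : Set where
    constructor within
    field
      size-bound : size B ≤ ⟦ l ⟧
      depth-bound : depth B ≤ d₀ + k

  record AllWithin (l : Lin) (k : ℕ) (Γ : List (Form n)) : Set where
    constructor allWithin
    field
      sizes-bound : sizes Γ ≤ ⟦ l ⟧
      depths-bound : depths Γ ≤ d₀ + k

  within-var : ∀ {k} → Within 𝟙 0 (var k)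
  within-var = within ≤-refl z≤n

  within-¬ : ∀ {l k A} → Within l k A → Within (𝟙 ⊕ l) (suc k) (¬f A)
  within-¬ {l} {k} (within s d) =
    within (≤-trans (s≤s s) (≤-reflexive (sym (⟦⟧-⊕ 𝟙 l)))) (≤-trans (s≤s d) (≤-reflexive (sym (+-suc d₀ k))))

  within-⋁ : ∀ {l k Γ} → AllWithin l k Γ → Within (𝟙 ⊕ l) (suc k) (⋁ Γ)
  within-⋁ {l} {k} (allWithin s d) =
    within (≤-trans (s≤s s) (≤-reflexive (sym (⟦⟧-⊕ 𝟙 l)))) (≤-trans (s≤s d) (≤-reflexive (sym (+-suc d₀ k))))

  within-[] : AllWithin 𝟘 0 []
  within-[] = allWithin z≤n z≤n

  within-∷ : ∀ {l l' k k' A Γ} → Within l k A → AllWithin l' k' Γ → AllWithin (l ⊕ l') (k ⊔ k') (A ∷ Γ)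
  within-∷ {l} {l'} {k} {k'} (within s d) (allWithin s' d') =
    allWithin (≤-trans (+-mono-≤ s s') (≤-reflexive (sym (⟦⟧-⊕ l l'))))
              (≤-trans (⊔-mono-≤ d d') (≤-reflexive (sym (+-distribˡ-⊔ d₀ k k'))))

  within-++ : ∀ {l l' k k' Γ Δ} → AllWithin l k Γ → AllWithin l' k' Δ → AllWithin (l ⊕ l') (k ⊔ k') (Γ ++ Δ)
  within-++ {l} {l'} {k} {k'} {Γ} {Δ} (allWithin s d) (allWithin s' d') =
    allWithin (≤-trans (≤-reflexive (sizes-++ Γ Δ)) (≤-trans (+-mono-≤ s s') (≤-reflexive (sym (⟦⟧-⊕ l l')))))
              (≤-trans (≤-reflexive (depths-++ Γ Δ)) (≤-trans (⊔-mono-≤ d d') (≤-reflexive (sym (+-distribˡ-⊔ d₀ k k')))))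

  within-⋁₂ : ∀ {l l' k k' A B} → Within l k A → Within l' k' B →
              Within (𝟙 ⊕ (l ⊕ (l' ⊕ 𝟘))) (suc (k ⊔ (k' ⊔ 0))) (⋁ (A ∷ B ∷ []))
  within-⋁₂ a b = within-⋁ (within-∷ a (within-∷ b within-[]))

  within-¬⁻ : ∀ {l k A} → Within l k (¬f A) → Within l k A
  within-¬⁻ (within s d) = within (≤-trans (n≤1+n _) s) (≤-trans (n≤1+n _) d)

  within-⋁⁻ : ∀ {l k Γ} → Within l k (⋁ Γ) → AllWithin l k Γ
  within-⋁⁻ (within s d) = allWithin (≤-trans (n≤1+n _) s) (≤-trans (n≤1+n _) d)

  within-∈ : ∀ {l k B Γ} → B ∈ Γ → AllWithin l k Γ → Within l k B
  within-∈ {Γ = Γ} B∈Γ (allWithin s d) =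
    within (≤-trans (All.lookup (size≤sizes Γ) B∈Γ) s) (≤-trans (All.lookup (depth≤depths Γ) B∈Γ) d)

  within-tail : ∀ {l k A Γ} → AllWithin l k (A ∷ Γ) → AllWithin l k Γ
  within-tail (allWithin s d) = allWithin (≤-trans (m≤n+m _ _) s) (≤-trans (m≤n⊔m _ _) d)

  fits : ∀ {l k B} → Within l k B → {{T (l ⊑ᵇ ⟨ 5 , 3 , 20 ⟩)}} → {{T (k ≤ᵇ 3)}} → Fits K Dp B
  fits {l} {k} (within s d) {{l⊑}} {{k≤}} =
    ≤-trans s (⟦⟧-mono l _ l⊑) , ≤-trans d (+-monoʳ-≤ d₀ (≤ᵇ⇒≤ k 3 k≤))

  snoc⊆cons : ∀ {A : Set} (xs : List A) x → xs ++ x ∷ [] ⊆ x ∷ xs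
  snoc⊆cons xs x y∈ with ∈-++⁻ xs y∈
  ... | inj₁ y∈xs = there y∈xs
  ... | inj₂ (here refl) = here refl

  cons⊆snoc : ∀ {A : Set} (xs : List A) x → x ∷ xs ⊆ xs ++ x ∷ []
  cons⊆snoc xs x (here refl) = ∈-++⁺ʳ xs (here refl)
  cons⊆snoc xs x (there y∈xs) = ∈-++⁺ˡ y∈xs

  ++-lub : ∀ {A : Set} {xs ys zs : List A} → xs ⊆ zs → ys ⊆ zs → xs ++ ys ++ [] ⊆ zs
  ++-lub {xs = xs} {ys} xs⊆zs ys⊆zs u∈ with ∈-++⁻ xs u∈
  ... | inj₁ u∈xs = xs⊆zs u∈xs
  ... | inj₂ u∈ys++[] = ys⊆zs (subst (_ ∈_) (++-identityʳ ys) u∈ys++[])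

  ⊆-++-middle : ∀ {A : Set} (xs ys : List A) → ys ⊆ xs ++ ys ++ []
  ⊆-++-middle xs ys y∈ys = ∈-++⁺ʳ xs (∈-++⁺ˡ y∈ys)

  split : ∀ {N Γ} A Δ → Γ ⊆ A ∷ Δ → A ∷ Δ ⊆ Γ → Fits K Dp (⋁ (A ∷ ⋁ Δ ∷ [])) →
          Line N (⋁ Γ) → Line (2 + N) (⋁ (A ∷ ⋁ Δ ∷ []))
  split {Γ = Γ} A Δ Γ⊆ ⊆Γ f p =
    unmergeᴾ (A ∷ []) Δ [] f
      (reorderᴾ (subst (Γ ⊆_) A∷Δ≡ Γ⊆) (subst (_⊆ Γ) A∷Δ≡ ⊆Γ) (merge-fits (A ∷ []) Δ [] f) p)
    where
    A∷Δ≡ : A ∷ Δ ≡ A ∷ Δ ++ []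
    A∷Δ≡ = cong (A ∷_) (sym (++-identityʳ Δ))

  flatten : ∀ {N X Y} → Line N (⋁ (⋁ X ∷ ⋁ Y ∷ [])) → Line (2 + N) (⋁ (X ++ Y ++ []))
  flatten {X = X} {Y} p = mergeᴾ X Y [] (mergeᴾ [] X (⋁ Y ∷ []) p)

  widen : ∀ {N Γ Δ} → Γ ⊆ Δ → Fits K Dp (⋁ (⋁ Γ ∷ ⋁ Δ ∷ [])) → Line N (⋁ Γ) → Line (4 + N) (⋁ Δ)
  widen {Γ = Γ} {Δ} Γ⊆Δ f p =
    reorderᴾ (++-lub Γ⊆Δ ⊆-refl) (⊆-++-middle Γ Δ) (component-fits {Γ = ⋁ Γ ∷ ⋁ Δ ∷ []} (there (here refl)) f) (flatten (weakᴾ (⋁ Δ) f p))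

  module Decide (α : Assignment n) (D : List (Form n))
                (covers : ∀ {k} → k ∈ V → falseLit (k , α k) ∈ D)
                (wD : AllWithin 𝕤 1 D) where

    -- D lists the literals that α falsifies; every ψ over V is decided under α by the line
    -- D ∨ ψ or D ∨ ¬ψ, in a number of steps linear in the size of ψ.
    Decided : Form n → Set
    Decided ψ = ∃ λ N → N + 10 ≤ 20 * size ψ × Line N (⋁ (D ++ signed (eval α ψ) ψ ∷ []))

    Refuted : Form n → Set
    Refuted B = ∃ λ N → N + 10 ≤ 20 * size B × Line N (⋁ (D ++ ¬f B ∷ []))

    covered : ∀ {k b} → k ∈ V → α k ≡ b → falseLit (k , b) ∈ D
    covered k∈V refl = covers k∈V

    cutAll-count : ∀ M N b s → N + 10 ≤ 20 * b → suc (2 + suc (2 + M + (2 + N))) + 20 * s ≤ M + 20 * (b + s)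
    cutAll-count M N b s N≤ = begin
      suc (2 + suc (2 + M + (2 + N))) + 20 * s ≡⟨ shuffle M N s ⟩
      M + (N + 8 + 20 * s)                     ≤⟨ +-monoʳ-≤ M (+-monoˡ-≤ (20 * s) (≤-trans (m≤m+n (N + 8) 2) (≤-reflexive (+-assoc N 8 2)))) ⟩
      M + (N + 10 + 20 * s)                    ≤⟨ +-monoʳ-≤ M (+-monoˡ-≤ (20 * s) N≤) ⟩
      M + (20 * b + 20 * s)                    ≡⟨ cong (M +_) (sym (*-distribˡ-+ 20 b s)) ⟩
      M + 20 * (b + s)                         ∎
      where
      open ≤-Reasoning
      shuffle : ∀ M N s → suc (2 + suc (2 + M + (2 + N))) + 20 * s ≡ M + (N + 8 + 20 * s)
      shuffle = solve-∀

    step-count : ∀ N a b → N + 10 ≤ 20 * a → a ≤ b → 5 + N + 10 ≤ 20 * suc b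
    step-count N a b N≤ a≤b = begin
      5 + N + 10   ≡⟨ +-assoc 5 N 10 ⟩
      5 + (N + 10) ≤⟨ +-monoʳ-≤ 5 N≤ ⟩
      5 + 20 * a   ≤⟨ +-mono-≤ (m≤m+n 5 15) (*-monoʳ-≤ 20 a≤b) ⟩
      20 + 20 * b  ≡⟨ sym (*-suc 20 b) ⟩
      20 * suc b   ∎
      where open ≤-Reasoning

    cutAll : ∀ E → D ⊆ E → AllWithin ⟨ 1 , 1 , 1 ⟩ 1 E →
             ∀ Γ₁ → AllWithin 𝕫 0 Γ₁ → All Refuted Γ₁ →
             ∀ {M} → Line M (⋁ (Γ₁ ++ E)) → Line (M + 20 * sizes Γ₁) (⋁ E)
    cutAll E D⊆E wE [] _ [] {M} p = relax (m≤m+n M 0) p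
    cutAll E D⊆E wE (B ∷ Γ₁) wBΓ₁ ((N , N≤ , refutation) ∷ rs) {M} p =
      relax (cutAll-count M N (size B) (sizes Γ₁) N≤)
        (cutAll E D⊆E wE Γ₁ wΓ₁ rs
          (reorderᴾ (++-lub ⊆-refl (λ x∈D → ∈-++⁺ʳ Γ₁ (D⊆E x∈D))) (xs⊆xs++ys X (D ++ []))
                    (component-fits {Γ = ⋁ X ∷ ⋁ D ∷ []} (here refl) fcut)
            (flatten (cutᴾ fcut
              (split B X ⊆-refl ⊆-refl (fits (within-⋁₂ wB (within-⋁ wX))) p)
              (split (¬f B) D (snoc⊆cons D (¬f B)) (cons⊆snoc D (¬f B))
                     (fits (within-⋁₂ (within-¬ wB) (within-⋁ wD))) refutation)))))
      where
      X = Γ₁ ++ E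
      wB = within-∈ (here refl) wBΓ₁
      wΓ₁ = within-tail wBΓ₁
      wX = within-++ wΓ₁ wE
      fcut = fits (within-⋁₂ (within-⋁ wX) (within-⋁ wD))

    mutual
      decide : ∀ ψ → UsesOnly V ψ → Within 𝕫 0 ψ → Decided ψ
      decide (var k) k∈V _ with α k in αk
      ... | true =
        5 , m≤m+n 15 5 ,
        widen {Γ = var k ∷ ¬f (var k) ∷ []} (λ { (here refl) → ∈-++⁺ʳ D (here refl)
                                               ; (there (here refl)) → ∈-++⁺ˡ (covered k∈V αk) })
              (fits (within-⋁₂ (within-⋁₂ within-var (within-¬ within-var))
                               (within-⋁ (within-++ wD (within-∷ within-var within-[])))))
              (axiomᴾ (var k) (fits (within-⋁₂ within-var (within-¬ within-var))))
      ... | false =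
        5 , m≤m+n 15 5 ,
        widen {Γ = var k ∷ ¬f (var k) ∷ []} (λ { (here refl) → ∈-++⁺ˡ (covered k∈V αk)
                                               ; (there (here refl)) → ∈-++⁺ʳ D (here refl) })
              (fits (within-⋁₂ (within-⋁₂ within-var (within-¬ within-var))
                               (within-⋁ (within-++ wD (within-∷ (within-¬ within-var) within-[])))))
              (axiomᴾ (var k) (fits (within-⋁₂ within-var (within-¬ within-var))))
      decide (¬f A) uA wA with eval α A | decide A uA (within-¬⁻ wA)
      ... | false | N , N≤ , p = N , ≤-trans N≤ (*-monoʳ-≤ 20 (n≤1+n _)) , p
      ... | true | N , N≤ , p =
        5 + N , step-count N (size A) (size A) N≤ ≤-refl ,
        relax (≤-reflexive (cong (λ x → 2 + x) (+-comm (2 + N) 1)))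
          (mergeᴾ [] D (¬f (¬f A) ∷ [])
            (cutᴾ (fits (within-⋁₂ (within-⋁ wD) (within-¬ (within-¬ wA'))))
              (split A D (snoc⊆cons D A) (cons⊆snoc D A) (fits (within-⋁₂ wA' (within-⋁ wD))) p)
              (axiomᴾ (¬f A) (fits (within-⋁₂ (within-¬ wA') (within-¬ (within-¬ wA')))))))
        where
        wA' = within-¬⁻ wA
      decide (⋁ Γ) uΓ wψ with evalAny α Γ in evΓ
      ... | true with evalAny-true⁻ α Γ evΓ
      ...   | B , B∈Γ , evB with All.lookup (decideAll Γ uΓ (within-⋁⁻ wψ)) B∈Γ
      ...     | N , N≤ , p =
        5 + N , step-count N (size B) (sizes Γ) N≤ (All.lookup (size≤sizes Γ) B∈Γ) ,
        unmergeᴾ D Γ [] (fits (within-⋁ (within-++ wD (within-∷ wψ within-[]))))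
          (widen (++⁺ʳ-⊆ D (λ { (here refl) → ∈-++⁺ˡ B∈Γ }))
                 (fits (within-⋁₂ (within-⋁ (within-++ wD (within-∷ (within-∈ B∈Γ wΓ) within-[])))
                                  (within-⋁ (within-++ wD (within-++ wΓ within-[])))))
                 (subst (λ b → Line N (⋁ (D ++ signed b B ∷ []))) evB p))
        where
        wΓ = within-⋁⁻ wψ
      decide (⋁ Γ) uΓ wψ | false =
        6 + 20 * sizes Γ , refute-count ,
        cutAll E (xs⊆xs++ys D _) wE Γ wΓ refutations
          (widen (++⁺ʳ-⊆ Γ (xs⊆ys++xs _ D))
                 (fits (within-⋁₂ (within-⋁ (within-++ wΓ (within-∷ (within-¬ wψ) within-[])))
                                  (within-⋁ (within-++ wΓ wE))))
            (mergeᴾ [] Γ (¬f ψ ∷ [])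
              (axiomᴾ ψ (fits (within-⋁₂ wψ (within-¬ wψ))))))
        where
        ψ = ⋁ Γ
        E = D ++ ¬f ψ ∷ []
        wΓ = within-⋁⁻ wψ
        wE = within-++ wD (within-∷ (within-¬ wψ) within-[])
        refutations : All Refuted Γ
        refutations = All.zipWith (λ { (evB , N , N≤ , p) → N , N≤ , subst (λ b → Line N (⋁ (D ++ signed b _ ∷ []))) evB p })
                                  (evalAny-false⁻ α Γ evΓ , decideAll Γ uΓ wΓ)
        refute-count : 6 + 20 * sizes Γ + 10 ≤ 20 * suc (sizes Γ)
        refute-count = ≤-trans (m≤m+n _ 4) (≤-reflexive (regroup (sizes Γ)))
          where
          regroup : ∀ a → 6 + 20 * a + 10 + 4 ≡ 20 * suc a
          regroup = solve-∀

      decideAll : ∀ Γ → AllUseOnly V Γ → AllWithin 𝕫 0 Γ → All Decided Γ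
      decideAll [] _ _ = []
      decideAll (A ∷ Γ) (uA , uΓ) wAΓ = decide A uA (within-∈ (here refl) wAΓ) ∷ decideAll Γ uΓ (within-tail wAΓ)

  falseLits-within : ∀ σ → length σ ≤ length V → AllWithin 𝕤 1 (falseLits σ)
  falseLits-within σ σ≤V =
    allWithin (≤-trans (sizes≤ σ) (≤-trans (*-monoʳ-≤ 2 σ≤V) (≤-reflexive (sym ⟦𝕤⟧))))
              (≤-trans (depths≤ σ) (m≤n+m 1 d₀))
    where
    sizes≤ : ∀ σ → sizes (falseLits σ) ≤ 2 * length σ
    sizes≤ [] = z≤n
    sizes≤ ((v , b) ∷ σ) = ≤-trans (+-mono-≤ (lit≤ b) (sizes≤ σ)) (≤-reflexive (sym (*-suc 2 (length σ))))
      where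
      lit≤ : ∀ b → size (falseLit (v , b)) ≤ 2
      lit≤ true = ≤-refl
      lit≤ false = s≤s z≤n
    depths≤ : ∀ σ → depths (falseLits σ) ≤ 1
    depths≤ [] = z≤n
    depths≤ ((v , b) ∷ σ) = ⊔-lub (lit≤ b) (depths≤ σ)
      where
      lit≤ : ∀ b → depth (falseLit (v , b)) ≤ 1
      lit≤ true = ≤-refl
      lit≤ false = z≤n

  -- A semantic consequence φ of a hypothesis h over the variables V
  -- is derived by deciding every formula under each of the 2^|V| assignments to V
  -- and cutting the resulting case distinction on the variables one at a time.
  module Complete (h φ : Form n) (h∈H : h ∈ H) (uh : UsesOnly V h) (uφ : UsesOnly V φ)
                  (h⊨φ : ∀ α → eval α h ≡ true → eval α φ ≡ true)
                  (wh : Within 𝕫 0 h) (wφ : Within 𝕫 0 φ) where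

    size-h : size h ≤ Z
    size-h = subst (size h ≤_) ⟦𝕫⟧ (Within.size-bound wh)

    size-φ : size φ ≤ Z
    size-φ = subst (size φ ≤_) ⟦𝕫⟧ (Within.size-bound wφ)

    covers : ∀ σ → V ⊆ map proj₁ σ → ∀ {k} → k ∈ V → falseLit (k , assignmentOf σ k) ∈ falseLits σ
    covers σ V⊆σ k∈V = falseLits-covers σ (V⊆σ k∈V)

    leaf : (σ : Context) → length σ ≤ length V → V ⊆ map proj₁ σ → Line (20 * Z) (⋁ (falseLits σ ++ φ ∷ []))
    leaf σ σ≤V V⊆σ with eval (assignmentOf σ) h in evh
    ... | true with Decide.decide (assignmentOf σ) (falseLits σ) (covers σ V⊆σ) (falseLits-within σ σ≤V) φ uφ wφ
    ...   | N , N≤ , p =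
      relax (≤-trans (m≤m+n N 10) (≤-trans N≤ (*-monoʳ-≤ 20 size-φ)))
        (subst (λ b → Line N (⋁ (falseLits σ ++ signed b φ ∷ []))) (h⊨φ (assignmentOf σ) evh) p)
    leaf σ σ≤V V⊆σ | false with Decide.decide (assignmentOf σ) (falseLits σ) (covers σ V⊆σ) (falseLits-within σ σ≤V) h uh wh
    ...   | N , N≤ , p =
      relax (≤-trans (≤-reflexive (count N)) (≤-trans (+-monoʳ-≤ N (m≤m+n 7 3)) (≤-trans N≤ (*-monoʳ-≤ 20 size-h))))
        (reorderᴾ (⊆-trans (∷⁺ʳ φ (⊆-reflexive (++-identityʳ D))) (cons⊆snoc D φ))
                  (⊆-trans (snoc⊆cons D φ) (∷⁺ʳ φ (⊆-reflexive (sym (++-identityʳ D)))))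
                  (fits (within-⋁ (within-++ wD (within-∷ wφ within-[]))))
          (mergeᴾ (φ ∷ []) D []
            (cutᴾ (fits (within-⋁₂ wφ (within-⋁ wD)))
              (weakᴾ φ fhφ (hypᴾ h∈H (component-fits {Γ = h ∷ φ ∷ []} (here refl) fhφ)))
              (split (¬f h) D (snoc⊆cons D (¬f h)) (cons⊆snoc D (¬f h))
                     (fits (within-⋁₂ (within-¬ wh) (within-⋁ wD)))
                     (subst (λ b → Line N (⋁ (D ++ signed b h ∷ []))) evh p)))))
      where
      D = falseLits σ
      wD = falseLits-within σ σ≤V
      fhφ = fits (within-⋁₂ wh wφ)
      count : ∀ N → suc (suc (suc (2 + (2 + N)))) ≡ N + 7
      count = solve-∀

    caseSplit : (W : List (Fin n)) (σ : Context) → length σ + length W ≡ length V → V ⊆ W ++ map proj₁ σ →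
                ∃ λ N → N + 8 ≤ 2 ^ length W * (20 * Z + 8) × Line N (⋁ (falseLits σ ++ φ ∷ []))
    caseSplit [] σ σW≡V V⊆ =
      20 * Z , ≤-reflexive (sym (+-identityʳ _)) , leaf σ (≤-trans (m≤m+n _ 0) (≤-reflexive σW≡V)) V⊆
    caseSplit (v ∷ W) σ σW≡V V⊆ with caseSplit W ((v , false) ∷ σ) σW≡V' V⊆' | caseSplit W ((v , true) ∷ σ) σW≡V' V⊆'
      where
      σW≡V' : suc (length σ) + length W ≡ length V
      σW≡V' = trans (sym (+-suc (length σ) (length W))) σW≡V
      V⊆' : V ⊆ W ++ v ∷ map proj₁ σ
      V⊆' u∈V with V⊆ u∈V
      ... | here refl = ∈-++⁺ʳ W (here refl)
      ... | there u∈ with ∈-++⁻ W u∈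
      ...   | inj₁ u∈W = ∈-++⁺ˡ u∈W
      ...   | inj₂ u∈σ = ∈-++⁺ʳ W (there u∈σ)
    ... | N₀ , N₀≤ , p₀ | N₁ , N₁≤ , p₁ =
      _ , ≤-trans (count N₀ N₁ N₀≤ N₁≤) (≤-reflexive (sym (*-assoc 2 (2 ^ length W) (20 * Z + 8)))) ,
      reorderᴾ (++-lub ⊆-refl ⊆-refl) (xs⊆xs++ys R (R ++ [])) (component-fits {Γ = ⋁ R ∷ ⋁ R ∷ []} (here refl) fcut)
        (flatten (cutᴾ fcut (split (var v) R ⊆-refl ⊆-refl (fits (within-⋁₂ within-var (within-⋁ wR))) p₀)
                            (split (¬f (var v)) R ⊆-refl ⊆-refl (fits (within-⋁₂ (within-¬ within-var) (within-⋁ wR))) p₁)))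
      where
      R = falseLits σ ++ φ ∷ []
      wR = within-++ (falseLits-within σ (≤-trans (m≤m+n _ _) (≤-reflexive σW≡V))) (within-∷ wφ within-[])
      fcut = fits (within-⋁₂ (within-⋁ wR) (within-⋁ wR))
      count : ∀ N₀ N₁ {X} → N₀ + 8 ≤ X → N₁ + 8 ≤ X → suc (2 + suc (2 + N₀ + (2 + N₁))) + 8 ≤ 2 * X
      count N₀ N₁ {X} N₀≤ N₁≤ = ≤-trans (≤-reflexive (regroup N₀ N₁)) (≤-trans (+-mono-≤ N₀≤ N₁≤) (≤-reflexive (cong (X +_) (sym (+-identityʳ X)))))
        where
        regroup : ∀ a b → suc (2 + suc (2 + a + (2 + b))) + 8 ≡ (a + 8) + (b + 8)
        regroup = solve-∀

    complete : Line (2 ^ length V * (20 * Z + 8)) φ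
    complete with caseSplit V [] refl (xs⊆xs++ys V [])
    ... | N , N≤ , p = relax (≤-trans (s≤s (m≤m+n N 7)) (≤-trans (≤-reflexive (sym (+-suc N 7))) N≤)) (singleᴾ p)

module ListFacts {A : Set} where

  open import Data.Nat using (suc; zero; _+_; _*_; _∸_; _≤_; z≤n; s≤s)
  open import Data.Nat.Properties
  open import Data.Nat.ListAction using (sum)
  open import Data.Bool using (Bool; true; false; T; if_then_else_)
  open import Data.Bool.Properties using (T-≡)
  open import Data.List using (List; []; _∷_; _++_; map; length; take; drop; concat; filterᵇ; replicate; concatMap)
  open import Data.List.Properties using (length-take; length-drop; take++drop≡id; length-++; filter-++; filter-≐)
  open import Data.List.Relation.Unary.All as All using (All; []; _∷_)
  open import Data.List.Relation.Unary.AllPairs using ([]; _∷_)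
  open import Data.List.Relation.Unary.Unique.Propositional using (Unique)
  open import Data.List.Relation.Unary.Any using (here; there)
  open import Data.List.Membership.Propositional using (_∈_)
  open import Data.List.Membership.Propositional.Properties using (∈-++⁺ˡ; ∈-++⁺ʳ; ∈-filter⁻; ∈-filter⁺; ∈-concat⁺′)
  open import Data.List.Relation.Binary.Subset.Propositional using (_⊆_)
  open import Data.Product using (_×_; _,_; map₂)
  open import Data.Sum using (_⊎_; inj₁; inj₂)
  open import Function using (_∘_; Equivalence)
  open import Relation.Nullary using (¬_; contradiction)
  open import Relation.Nullary.Decidable using (T?)
  open import Relation.Binary.PropositionalEquality

  ∈-filterᵇ⁻ : ∀ (P : A → Bool) {xs x} → x ∈ filterᵇ P xs → x ∈ xs × P x ≡ true
  ∈-filterᵇ⁻ P x∈ = map₂ (Equivalence.to T-≡) (∈-filter⁻ (T? ∘ P) x∈)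

  ∈-filterᵇ⁺ : ∀ (P : A → Bool) {xs x} → x ∈ xs → P x ≡ true → x ∈ filterᵇ P xs
  ∈-filterᵇ⁺ P x∈ Px = ∈-filter⁺ (T? ∘ P) x∈ (Equivalence.from T-≡ Px)

  filterᵇ-cong : ∀ (P Q : A → Bool) xs → (∀ x → P x ≡ Q x) → filterᵇ P xs ≡ filterᵇ Q xs
  filterᵇ-cong P Q xs P≗Q = filter-≐ (T? ∘ P) (T? ∘ Q) ((λ {x} → subst T (P≗Q x)) , (λ {x} → subst T (sym (P≗Q x)))) xs

  length-filterᵇ-map : ∀ {B : Set} (P : B → Bool) (f : A → B) xs →
                       length (filterᵇ (P ∘ f) xs) ≡ length (filterᵇ P (map f xs))
  length-filterᵇ-map P f [] = refl
  length-filterᵇ-map P f (x ∷ xs) with P (f x)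
  ... | true = cong suc (length-filterᵇ-map P f xs)
  ... | false = length-filterᵇ-map P f xs

  length-filterᵇ-copies : ∀ (P : A → Bool) (g : A → ℕ) Is →
    length (filterᵇ P (concatMap (λ I → replicate (g I) I) Is)) ≡ sum (map (λ I → if P I then g I else 0) Is)
  length-filterᵇ-copies P g [] = refl
  length-filterᵇ-copies P g (I ∷ Is) = begin
    length (filterᵇ P (replicate (g I) I ++ rest))                 ≡⟨ cong length (filter-++ (T? ∘ P) (replicate (g I) I) rest) ⟩
    length (filterᵇ P (replicate (g I) I) ++ filterᵇ P rest)        ≡⟨ length-++ (filterᵇ P (replicate (g I) I)) ⟩
    length (filterᵇ P (replicate (g I) I)) + length (filterᵇ P rest) ≡⟨ cong₂ _+_ (copies (g I)) (length-filterᵇ-copies P g Is) ⟩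
    _ ∎
    where
    open ≡-Reasoning
    rest = concatMap (λ I → replicate (g I) I) Is
    copies : ∀ k → length (filterᵇ P (replicate k I)) ≡ (if P I then k else 0)
    copies zero with P I
    ... | true = refl
    ... | false = refl
    copies (suc k) with P I in PI
    ... | true = cong suc (trans (copies k) (cong (λ b → if b then k else 0) PI))
    ... | false = trans (copies k) (cong (λ b → if b then k else 0) PI)

  length-concatMap≤ : ∀ {B : Set} (f : A → List B) xs b → (∀ x → length (f x) ≤ b) → length (concatMap f xs) ≤ length xs * b
  length-concatMap≤ f [] b _ = z≤n
  length-concatMap≤ f (x ∷ xs) b f≤ = ≤-trans (≤-reflexive (length-++ (f x))) (+-mono-≤ (f≤ x) (length-concatMap≤ f xs b f≤))

  chunks : ℕ → ℕ → List A → List (List A)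
  chunks q zero L = []
  chunks q (suc t) L = take q L ∷ chunks q t (drop q L)

  concat-chunks : ∀ q t (L : List A) → length L ≤ t * q → concat (chunks q t L) ≡ L
  concat-chunks q zero [] _ = refl
  concat-chunks q (suc t) L L≤ =
    trans (cong (take q L ++_) (concat-chunks q t (drop q L) rest≤)) (take++drop≡id q L)
    where
    rest≤ : length (drop q L) ≤ t * q
    rest≤ = subst (_≤ t * q) (sym (length-drop q L))
              (subst (length L ∸ q ≤_) (m+n∸m≡n q (t * q)) (∸-monoˡ-≤ q L≤))

  chunk-length : ∀ q t s (L : List A) → length L ≡ s * q → ∀ {c} → c ∈ chunks q t L → c ≡ [] ⊎ length c ≡ q
  chunk-length q (suc t) zero [] _ (here refl) = inj₁ (take-[] q)
    where
    take-[] : ∀ q → take {A = A} q [] ≡ []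
    take-[] zero = refl
    take-[] (suc q) = refl
  chunk-length q (suc t) (suc s) L L≡ (here refl) =
    inj₂ (trans (length-take q L) (m≤n⇒m⊓n≡m (subst (q ≤_) (sym L≡) (m≤m+n q (s * q)))))
  chunk-length q (suc t) zero L L≡ (there c∈) =
    chunk-length q t 0 (drop q L) (trans (length-drop q L) (trans (cong (_∸ q) L≡) (0∸n≡0 q))) c∈
  chunk-length q (suc t) (suc s) L L≡ (there c∈) =
    chunk-length q t s (drop q L) (trans (length-drop q L) (trans (cong (_∸ q) L≡) (m+n∸m≡n q (s * q)))) c∈

  unique-++ʳ : ∀ (xs ys : List A) → Unique (xs ++ ys) → Unique ys
  unique-++ʳ [] ys u = u
  unique-++ʳ (x ∷ xs) ys (_ ∷ u) = unique-++ʳ xs ys u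

  unique-++ˡ : ∀ (xs ys : List A) → Unique (xs ++ ys) → Unique xs
  unique-++ˡ [] ys u = []
  unique-++ˡ (x ∷ xs) ys (x∉ ∷ u) = All.tabulate (λ y∈xs → All.lookup x∉ (∈-++⁺ˡ y∈xs)) ∷ unique-++ˡ xs ys u

  unique-++-disjoint : ∀ (xs ys : List A) {x} → Unique (xs ++ ys) → x ∈ xs → ¬ x ∈ ys
  unique-++-disjoint (a ∷ xs) ys (a∉ ∷ u) (here refl) x∈ys = All.lookup a∉ (∈-++⁺ʳ xs x∈ys) refl
  unique-++-disjoint (a ∷ xs) ys (_ ∷ u) (there x∈xs) = unique-++-disjoint xs ys u x∈xs

  unique-concat : ∀ (cs : List (List A)) {c} → Unique (concat cs) → c ∈ cs → Unique c
  unique-concat (c ∷ cs) u (here refl) = unique-++ˡ c (concat cs) u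
  unique-concat (c ∷ cs) u (there c∈) = unique-concat cs (unique-++ʳ c (concat cs) u) c∈

  same-chunk : ∀ (cs : List (List A)) → Unique (concat cs) → ∀ {x c c'} →
               x ∈ c → c ∈ cs → x ∈ c' → c' ∈ cs → c ≡ c'
  same-chunk (d ∷ cs) u _ (here refl) _ (here refl) = refl
  same-chunk (d ∷ cs) u x∈c (here refl) x∈c' (there c'∈) =
    contradiction (∈-concat⁺′ x∈c' c'∈) (unique-++-disjoint d (concat cs) u x∈c)
  same-chunk (d ∷ cs) u x∈c (there c∈) x∈c' (here refl) =
    contradiction (∈-concat⁺′ x∈c c∈) (unique-++-disjoint d (concat cs) u x∈c')
  same-chunk (d ∷ cs) u x∈c (there c∈) x∈c' (there c'∈) =
    same-chunk cs (unique-++ʳ d (concat cs) u) x∈c c∈ x∈c' c'∈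

  unique-length≤ : ∀ (xs ys : List A) → Unique xs → xs ⊆ ys → length xs ≤ length ys
  unique-length≤ [] ys _ _ = z≤n
  unique-length≤ (x ∷ xs) ys (x∉ ∷ u) xs⊆ys with x∈ys ← xs⊆ys (here refl) =
    subst (suc (length xs) ≤_) (remove-length ys x∈ys)
      (s≤s (unique-length≤ xs (remove ys x∈ys) u
             (λ y∈xs → remove-∈ ys x∈ys (xs⊆ys (there y∈xs)) (λ y≡x → All.lookup x∉ y∈xs (sym y≡x)))))
    where
    remove : ∀ {x} (ys : List A) → x ∈ ys → List A
    remove (y ∷ ys) (here _) = ys
    remove (y ∷ ys) (there x∈) = y ∷ remove ys x∈
    remove-length : ∀ {x} (ys : List A) (x∈ : x ∈ ys) → suc (length (remove ys x∈)) ≡ length ys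
    remove-length (y ∷ ys) (here _) = refl
    remove-length (y ∷ ys) (there x∈) = cong suc (remove-length ys x∈)
    remove-∈ : ∀ {x z} (ys : List A) (x∈ : x ∈ ys) → z ∈ ys → z ≢ x → z ∈ remove ys x∈
    remove-∈ (y ∷ ys) (here refl) (here refl) z≢x = contradiction refl z≢x
    remove-∈ (y ∷ ys) (here refl) (there z∈) _ = z∈
    remove-∈ (y ∷ ys) (there x∈) (here refl) _ = here refl
    remove-∈ (y ∷ ys) (there x∈) (there z∈) z≢x = there (remove-∈ ys x∈ z∈ z≢x)

module Counting where

  open import Data.Nat as ℕ using (ℕ; zero; suc; NonZero)
  open import Data.Nat.ListAction using (sum)
  open import Data.Bool using (Bool; true; false; not; _∨_; _∧_; if_then_else_)
  open import Data.Bool.Properties using (∧-assoc; ∧-comm; ∧-identityʳ)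
  import Data.Bool as B
  open import Data.Fin using (Fin; zero; suc)
  open import Data.Fin.Subset using (Subset; ⊥)
  open import Data.Vec using (Vec; []; _∷_)
  import Data.Vec as V
  open import Data.Vec.Properties using (≡-dec)
  open import Data.List using (List; []; _∷_; _++_; map; length; filter; filterᵇ; foldr; allFin)
  import Data.List as L
  open import Data.List.Properties using (map-++; map-∘; map-tabulate; tabulate-lookup)
  open import Data.List.Relation.Unary.Any using (here; there)
  open import Data.Integer as ℤ using (ℤ; +_; -_; _+_; _*_) renaming (∣_∣ to abs)
  import Data.Integer.Properties as ℤ
  open import Data.Integer.DivMod using (_/ℕ_; a≡a%ℕn+[a/ℕn]*n)
  import Data.Integer.Tactic.RingSolver as ℤ-Solver
  open import Data.Product using (∃; _,_; proj₁; proj₂)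
  open import Relation.Nullary using (does)
  open import Relation.Binary.PropositionalEquality
  open import Function using (_∘_)
  open ListFacts

  holds : ∀ {n} → Assignment n → Subset n → Bool
  holds {zero} α [] = true
  holds {suc n} α (b ∷ I) = (not b ∨ α zero) ∧ holds (α ∘ suc) I

  evaluate : ∀ {n} → Assignment n → Poly n → ℤ
  evaluate α [] = + 0
  evaluate α (t ∷ p) = (if holds α (mlMon (proj₂ t)) then proj₁ t else + 0) + evaluate α p

  evaluate-++ : ∀ {n} (α : Assignment n) p p' → evaluate α (p ++ p') ≡ evaluate α p + evaluate α p'
  evaluate-++ α [] p' = sym (ℤ.+-identityˡ _)
  evaluate-++ α (t ∷ p) p' = trans (cong (_+_ (c)) (evaluate-++ α p p')) (sym (ℤ.+-assoc c (evaluate α p) _))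
    where c = if holds α (mlMon (proj₂ t)) then proj₁ t else + 0

  if-neg : ∀ b (c : ℤ) → (if b then - c else + 0) ≡ - (if b then c else + 0)
  if-neg true c = refl
  if-neg false c = refl

  evaluate-negP : ∀ {n} (α : Assignment n) p → evaluate α (negP p) ≡ - evaluate α p
  evaluate-negP α [] = refl
  evaluate-negP α (t ∷ p) =
    trans (cong₂ _+_ (if-neg (holds α (mlMon (proj₂ t))) (proj₁ t)) (evaluate-negP α p))
          (sym (ℤ.neg-distrib-+ (if holds α (mlMon (proj₂ t)) then proj₁ t else + 0) (evaluate α p)))

  mlMon-+0 : ∀ {n} (e : Vec ℕ n) → mlMon (V.zipWith ℕ._+_ e (V.map (λ b → if b then 1 else 0) ⊥)) ≡ mlMon e
  mlMon-+0 [] = refl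
  mlMon-+0 (zero ∷ e) = cong (false ∷_) (mlMon-+0 e)
  mlMon-+0 (suc x ∷ e) = cong (true ∷_) (mlMon-+0 e)

  holds-mulVar : ∀ {n} (α : Assignment n) (e : Vec ℕ n) k →
                 holds α (mlMon (V.zipWith ℕ._+_ e (unitExp k))) ≡ holds α (mlMon e) ∧ α k
  holds-mulVar α (zero ∷ e) zero =
    trans (cong (λ I → α zero ∧ holds (α ∘ suc) I) (mlMon-+0 e)) (∧-comm (α zero) _)
  holds-mulVar α (suc x ∷ e) zero =
    trans (cong (λ I → α zero ∧ holds (α ∘ suc) I) (mlMon-+0 e)) (idem (α zero) _)
    where
    idem : ∀ a s → a ∧ s ≡ (a ∧ s) ∧ a
    idem true s = sym (∧-identityʳ s)
    idem false s = refl
  holds-mulVar α (zero ∷ e) (suc k) =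
    trans (cong (true ∧_) (holds-mulVar (α ∘ suc) e k)) (sym (∧-assoc true _ (α (suc k))))
  holds-mulVar α (suc x ∷ e) (suc k) =
    trans (cong (α zero ∧_) (holds-mulVar (α ∘ suc) e k)) (sym (∧-assoc (α zero) _ (α (suc k))))

  if-∧ : ∀ s a (c : ℤ) → (if s ∧ a then c else + 0) ≡ (if a then (if s then c else + 0) else + 0)
  if-∧ s true c = cong (λ b → if b then c else + 0) (∧-identityʳ s)
  if-∧ true false c = refl
  if-∧ false false c = refl

  if-+ : ∀ a (x y : ℤ) → (if a then x else + 0) + (if a then y else + 0) ≡ (if a then x + y else + 0)
  if-+ true x y = refl
  if-+ false x y = refl

  if-0 : ∀ {A : Set} a (x : A) → (if a then x else x) ≡ x
  if-0 true x = refl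
  if-0 false x = refl

  evaluate-mulVar : ∀ {n} (α : Assignment n) k p → evaluate α (mulVar k p) ≡ (if α k then evaluate α p else + 0)
  evaluate-mulVar α k [] = sym (if-0 (α k) (+ 0))
  evaluate-mulVar α k (t ∷ p) =
    trans (cong₂ _+_ (trans (cong (λ b → if b then proj₁ t else + 0) (holds-mulVar α (proj₂ t) k))
                            (if-∧ (holds α (mlMon (proj₂ t))) (α k) (proj₁ t)))
                     (evaluate-mulVar α k p))
          (if-+ (α k) _ (evaluate α p))

  tr-vanishes : ∀ {n} (α : Assignment n) (C : Clause n) → ClauseSat α C → evaluate α (tr C) ≡ + 0
  tr-vanishes α (pos k ∷ A) sat =
    trans (evaluate-++ α (tr A) (negP (mulVar k (tr A))))
      (trans (cong (_+_ (evaluate α (tr A))) (trans (evaluate-negP α (mulVar k (tr A))) (cong -_ (evaluate-mulVar α k (tr A)))))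
        (cancel sat))
    where
    cancel : ClauseSat α (pos k ∷ A) → evaluate α (tr A) + - (if α k then evaluate α (tr A) else + 0) ≡ + 0
    cancel (here αk) rewrite αk = ℤ.+-inverseʳ (evaluate α (tr A))
    cancel (there satA) rewrite tr-vanishes α A satA | if-0 (α k) (+ 0) = refl
  tr-vanishes α (neg k ∷ A) sat = trans (evaluate-mulVar α k (tr A)) (vanish sat)
    where
    vanish : ClauseSat α (neg k ∷ A) → (if α k then evaluate α (tr A) else + 0) ≡ + 0
    vanish (here αk) rewrite αk = refl
    vanish (there satA) rewrite tr-vanishes α A satA = if-0 (α k) (+ 0)

  sumℤ : List ℤ → ℤ
  sumℤ = foldr _+_ (+ 0)

  sumℤ-++ : ∀ xs ys → sumℤ (xs ++ ys) ≡ sumℤ xs + sumℤ ys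
  sumℤ-++ [] ys = sym (ℤ.+-identityˡ _)
  sumℤ-++ (x ∷ xs) ys = trans (cong (_+_ (x)) (sumℤ-++ xs ys)) (sym (ℤ.+-assoc x (sumℤ xs) (sumℤ ys)))

  module _ {A : Set} where

    sumℤ-+ : ∀ (xs : List A) f g → sumℤ (map (λ x → f x + g x) xs) ≡ sumℤ (map f xs) + sumℤ (map g xs)
    sumℤ-+ [] f g = refl
    sumℤ-+ (x ∷ xs) f g = trans (cong (_+_ (f x + g x)) (sumℤ-+ xs f g)) (interchange (f x) (g x) _ _)
      where
      interchange : ∀ a b c d → a + b + (c + d) ≡ a + c + (b + d)
      interchange = ℤ-Solver.solve-∀

    sumℤ-cong : ∀ (xs : List A) {f g} → (∀ x → f x ≡ g x) → sumℤ (map f xs) ≡ sumℤ (map g xs)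
    sumℤ-cong [] _ = refl
    sumℤ-cong (x ∷ xs) f≗g = cong₂ _+_ (f≗g x) (sumℤ-cong xs f≗g)

    sumℤ-0 : ∀ (xs : List A) → sumℤ (map (λ _ → + 0) xs) ≡ + 0
    sumℤ-0 [] = refl
    sumℤ-0 (x ∷ xs) = trans (ℤ.+-identityˡ _) (sumℤ-0 xs)

    sumℤ-neg-* : ∀ (xs : List A) g c → sumℤ (map (λ x → - (g x * c)) xs) ≡ - (sumℤ (map g xs) * c)
    sumℤ-neg-* [] g c = refl
    sumℤ-neg-* (x ∷ xs) g c = trans (cong (_+_ (- (g x * c))) (sumℤ-neg-* xs g c)) (distrib (g x) (sumℤ (map g xs)) c)
      where
      distrib : ∀ a b c → - (a * c) + - (b * c) ≡ - ((a + b) * c)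
      distrib = ℤ-Solver.solve-∀

    +-sum : ∀ (h : A → ℕ) xs → + sum (map h xs) ≡ sumℤ (map (λ x → + h x) xs)
    +-sum h [] = refl
    +-sum h (x ∷ xs) = trans (ℤ.pos-+ (h x) (sum (map h xs))) (cong (_+_ (+ h x)) (+-sum h xs))

  ∑ : ∀ n → (Subset n → ℤ) → ℤ
  ∑ n f = sumℤ (map f (subsets n))

  ∑-suc : ∀ n (f : Subset (suc n) → ℤ) → ∑ (suc n) f ≡ ∑ n (λ I → f (false ∷ I)) + ∑ n (λ I → f (true ∷ I))
  ∑-suc n f = trans (cong sumℤ (map-++ f (map (false ∷_) (subsets n)) (map (true ∷_) (subsets n))))
               (trans (sumℤ-++ (map f (map (false ∷_) (subsets n))) _)
                      (cong₂ _+_ (cong sumℤ (sym (map-∘ (subsets n)))) (cong sumℤ (sym (map-∘ (subsets n))))))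

  _≟ᵇ_ : ∀ {n} (J I : Subset n) → Bool
  J ≟ᵇ I = does (≡-dec B._≟_ J I)

  ∑-indicator : ∀ n (J : Subset n) (f : Subset n → ℤ) → ∑ n (λ I → if J ≟ᵇ I then f I else + 0) ≡ f J
  ∑-indicator zero [] f = ℤ.+-identityʳ (f [])
  ∑-indicator (suc n) (false ∷ J) f =
    trans (∑-suc n _) (trans (cong₂ _+_ (∑-indicator n J (f ∘ (false ∷_))) (sumℤ-0 (subsets n))) (ℤ.+-identityʳ _))
  ∑-indicator (suc n) (true ∷ J) f =
    trans (∑-suc n _) (trans (cong₂ _+_ (sumℤ-0 (subsets n)) (∑-indicator n J (f ∘ (true ∷_)))) (ℤ.+-identityˡ _))

  mlCoeff : ∀ {n} → Poly n → Subset n → ℤ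
  mlCoeff p I = foldr _+_ (+ 0) (map proj₁ (filter (λ t → ≡-dec B._≟_ (mlMon (proj₂ t)) I) p))

  mlCoeff-∷ : ∀ {n} t (p : Poly n) I → mlCoeff (t ∷ p) I ≡ (if mlMon (proj₂ t) ≟ᵇ I then proj₁ t else + 0) + mlCoeff p I
  mlCoeff-∷ t p I with mlMon (proj₂ t) ≟ᵇ I
  ... | true = refl
  ... | false = sym (ℤ.+-identityˡ _)

  if-comm : ∀ a b (c : ℤ) → (if a then (if b then c else + 0) else + 0) ≡ (if b then (if a then c else + 0) else + 0)
  if-comm true b c = refl
  if-comm false true c = refl
  if-comm false false c = refl

  evaluate-ml : ∀ {n} (α : Assignment n) (p : Poly n) → ∑ n (λ I → if holds α I then mlCoeff p I else + 0) ≡ evaluate α p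
  evaluate-ml {n} α [] = trans (sumℤ-cong (subsets n) (λ I → if-0 (holds α I) (+ 0))) (sumℤ-0 (subsets n))
  evaluate-ml {n} α (t ∷ p) =
    trans (sumℤ-cong (subsets n) split)
     (trans (sumℤ-+ (subsets n) _ _)
       (cong₂ _+_ (trans (sumℤ-cong (subsets n) (λ I → if-comm (holds α I) (mlMon (proj₂ t) ≟ᵇ I) (proj₁ t)))
                         (∑-indicator n (mlMon (proj₂ t)) (λ I → if holds α I then proj₁ t else + 0)))
                  (evaluate-ml α p)))
    where
    split : ∀ I → (if holds α I then mlCoeff (t ∷ p) I else + 0) ≡
                  (if holds α I then (if mlMon (proj₂ t) ≟ᵇ I then proj₁ t else + 0) else + 0) + (if holds α I then mlCoeff p I else + 0)
    split I = trans (cong (λ c → if holds α I then c else + 0) (mlCoeff-∷ t p I))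
                    (sym (if-+ (holds α I) _ (mlCoeff p I)))

  length-filterᵇ-lookup : ∀ {A : Set} (P : A → Bool) (xs : List A) →
                          length (filterᵇ (P ∘ L.lookup xs) (allFin (length xs))) ≡ length (filterᵇ P xs)
  length-filterᵇ-lookup P xs =
    trans (length-filterᵇ-map P (L.lookup xs) (allFin (length xs)))
          (cong (length ∘ filterᵇ P) (trans (map-tabulate (λ i → i) (L.lookup xs)) (tabulate-lookup xs)))

  module _ (q : ℕ) .{{_ : NonZero q}} where

    coeff-residue : ∀ {n} (p : Poly n) I → + coeff q p I ≡ mlCoeff p I + - ((mlCoeff p I /ℕ q) * + q)
    coeff-residue p I = isolate (+ coeff q p I) (mlCoeff p I) ((mlCoeff p I /ℕ q) * + q) (a≡a%ℕn+[a/ℕn]*n (mlCoeff p I) q)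
      where
      isolate : ∀ r z d → z ≡ r + d → r ≡ z + - d
      isolate r z d z≡ = trans (sym (cancel r d)) (cong (_+ - d) (sym z≡))
        where
        cancel : ∀ r d → r + d + - d ≡ r
        cancel = ℤ-Solver.solve-∀

    -- Counted with multiplicity, the satisfied monomials number Σ_{I satisfied} (a_I mod q),
    -- which is congruent mod q to the value of p.
    satisfied-copies : ∀ {n} (α : Assignment n) (p : Poly n) → evaluate α p ≡ + 0 →
                       ∃ λ t → length (filterᵇ (holds α) (Mf q p)) ≡ t ℕ.* q
    satisfied-copies {n} α p p≡0 = abs X , abs-count
      where
      g : Subset n → ℤ
      g I = if holds α I then mlCoeff p I /ℕ q else + 0
      X : ℤ
      X = ∑ n g
      termwise : ∀ I → + (if holds α I then coeff q p I else 0) ≡ (if holds α I then mlCoeff p I else + 0) + - (g I * + q)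
      termwise I with holds α I
      ... | true = coeff-residue p I
      ... | false = refl
      count : + length (filterᵇ (holds α) (Mf q p)) ≡ + 0 + - (X * + q)
      count = begin
        + length (filterᵇ (holds α) (Mf q p))                         ≡⟨ cong +_ (length-filterᵇ-copies (holds α) (coeff q p) (subsets n)) ⟩
        + sum (map (λ I → if holds α I then coeff q p I else 0) (subsets n)) ≡⟨ +-sum _ (subsets n) ⟩
        ∑ n (λ I → + (if holds α I then coeff q p I else 0))            ≡⟨ sumℤ-cong (subsets n) termwise ⟩
        ∑ n (λ I → (if holds α I then mlCoeff p I else + 0) + - (g I * + q)) ≡⟨ sumℤ-+ (subsets n) _ _ ⟩
        ∑ n (λ I → if holds α I then mlCoeff p I else + 0) + ∑ n (λ I → - (g I * + q))
          ≡⟨ cong₂ _+_ (trans (evaluate-ml α p) p≡0) (sumℤ-neg-* (subsets n) g (+ q)) ⟩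
        + 0 + - (X * + q) ∎
        where open ≡-Reasoning
      abs-count : length (filterᵇ (holds α) (Mf q p)) ≡ abs X ℕ.* q
      abs-count = trans (cong abs count) (trans (cong abs (ℤ.+-identityˡ (- (X * + q))))
                    (trans (ℤ.∣-i∣≡∣i∣ (X * + q)) (ℤ.abs-* X (+ q))))

module Support where

  open import Data.Nat as ℕ using (ℕ; zero; suc; NonZero; _≤_; _*_; _+_; _^_; z≤n; s≤s)
  import Data.Nat.Properties as ℕ
  open import Data.Nat.ListAction using (sum)
  open import Data.Nat.ListAction.Properties using (sum-++)
  open import Data.Nat.DivMod using (m*n%n≡0)
  open import Data.Bool using (Bool; true; false; if_then_else_)
  import Data.Bool as B
  open import Data.Fin using (Fin; zero; suc)
  open import Data.Fin.Subset using (Subset; _∈_; ⊥)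
  open import Data.Fin.Subset.Properties using (_∈?_)
  import Data.Vec as V
  open import Data.Vec using (Vec; []; _∷_)
  open import Data.Vec.Properties using (≡-dec)
  open import Data.List using (List; []; _∷_; _++_; map; length; concatMap; filter; foldr; allFin; replicate)
  import Data.List as L
  open import Data.List.Properties using (length-map; length-++; map-++; map-∘; length-replicate)
  open import Data.List.Relation.Unary.Any using (Any; here; there)
  open import Data.List.Membership.Propositional.Properties using (∈-++⁻; ∈-map⁻; ∈-concatMap⁻; ∈-lookup; ∈-filter⁻)
  open import Data.List.Relation.Unary.Unique.Propositional.Properties using (filter⁺; allFin⁺)
  open import Data.Integer as ℤ using (ℤ)
  open import Data.Integer.DivMod using (n%ℕd<d)
  open import Data.Product using (∃; _×_; _,_; proj₁; proj₂)
  open import Data.Sum using (_⊎_; inj₁; inj₂)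
  open import Relation.Nullary using (¬_; contradiction)
  open import Relation.Binary.PropositionalEquality
  open import Function using (_∘_)
  open import Algebra.Properties.CommutativeSemigroup ℕ.+-commutativeSemigroup using (interchange)
  open Counting using (_≟ᵇ_)
  open ListFacts using (unique-length≤)

  litVar : ∀ {n} → Literal n → Fin n
  litVar (pos k) = k
  litVar (neg k) = k

  clauseVars : ∀ {n} → Clause n → List (Fin n)
  clauseVars = map litVar

  mlMon-0 : ∀ {n} (k : Fin n) → ¬ k ∈ mlMon (V.replicate n 0)
  mlMon-0 zero ()
  mlMon-0 (suc k) (V.there k∈) = mlMon-0 k k∈

  mlMon-+0⁻ : ∀ {n} (e : Vec ℕ n) {k} → k ∈ mlMon (V.zipWith _+_ e (V.map (λ b → if b then 1 else 0) ⊥)) → k ∈ mlMon e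
  mlMon-+0⁻ (zero ∷ e) (V.there k∈) = V.there (mlMon-+0⁻ e k∈)
  mlMon-+0⁻ (suc x ∷ e) V.here = V.here
  mlMon-+0⁻ (suc x ∷ e) (V.there k∈) = V.there (mlMon-+0⁻ e k∈)

  mlMon-mulVar⁻ : ∀ {n} (e : Vec ℕ n) k {k'} → k' ∈ mlMon (V.zipWith _+_ e (unitExp k)) → k' ∈ mlMon e ⊎ k' ≡ k
  mlMon-mulVar⁻ (x ∷ e) zero {zero} _ = inj₂ refl
  mlMon-mulVar⁻ (x ∷ e) zero {suc _} (V.there k'∈) = inj₁ (V.there (mlMon-+0⁻ e k'∈))
  mlMon-mulVar⁻ (suc x ∷ e) (suc k) V.here = inj₁ V.here
  mlMon-mulVar⁻ (x ∷ e) (suc k) (V.there k'∈) with mlMon-mulVar⁻ e k k'∈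
  ... | inj₁ k'∈e = inj₁ (V.there k'∈e)
  ... | inj₂ refl = inj₂ refl

  tr-support : ∀ {n} (C : Clause n) {t} → t ∈ₗ tr C → ∀ {k} → k ∈ mlMon (proj₂ t) → k ∈ₗ clauseVars C
  tr-support [] (here refl) {k} k∈ = contradiction k∈ (mlMon-0 k)
  tr-support (pos k ∷ A) t∈ k'∈ with ∈-++⁻ (tr A) t∈
  ... | inj₁ t∈A = there (tr-support A t∈A k'∈)
  ... | inj₂ t∈neg with ∈-map⁻ _ t∈neg
  ...   | t' , t'∈ , refl with ∈-map⁻ _ t'∈
  ...     | t'' , t''∈ , refl with mlMon-mulVar⁻ (proj₂ t'') k k'∈
  ...       | inj₁ k'∈t'' = there (tr-support A t''∈ k'∈t'')
  ...       | inj₂ refl = here refl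
  tr-support (neg k ∷ A) t∈ k'∈ with ∈-map⁻ _ t∈
  ... | t'' , t''∈ , refl with mlMon-mulVar⁻ (proj₂ t'') k k'∈
  ...   | inj₁ k'∈t'' = there (tr-support A t''∈ k'∈t'')
  ...   | inj₂ refl = here refl

  exactly-one : ∀ m (J : Subset m) → sum (map (λ I → if J ≟ᵇ I then 1 else 0) (subsets m)) ≡ 1
  exactly-one zero [] = refl
  exactly-one (suc m) (b ∷ J) = begin
    sum (map f (map (false ∷_) S ++ map (true ∷_) S))             ≡⟨ cong sum (map-++ f (map (false ∷_) S) _) ⟩
    sum (map f (map (false ∷_) S) ++ map f (map (true ∷_) S))     ≡⟨ sum-++ (map f (map (false ∷_) S)) _ ⟩
    sum (map f (map (false ∷_) S)) + sum (map f (map (true ∷_) S)) ≡⟨ cong₂ _+_ (cong sum (sym (map-∘ S))) (cong sum (sym (map-∘ S))) ⟩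
    sum (map (f ∘ (false ∷_)) S) + sum (map (f ∘ (true ∷_)) S)     ≡⟨ halves b ⟩
    1 ∎
    where
    open ≡-Reasoning
    S = subsets m
    f = λ I → if (b ∷ J) ≟ᵇ I then 1 else 0
    none : ∀ (Is : List (Subset m)) → sum (map (λ _ → 0) Is) ≡ 0
    none [] = refl
    none (_ ∷ Is) = none Is
    halves : ∀ b → sum (map (λ I → if (b ∷ J) ≟ᵇ (false ∷ I) then 1 else 0) S) +
                   sum (map (λ I → if (b ∷ J) ≟ᵇ (true ∷ I) then 1 else 0) S) ≡ 1
    halves false = trans (cong₂ _+_ (exactly-one m J) (none S)) refl
    halves true = cong₂ _+_ (none S) (exactly-one m J)

  module _ (q : ℕ) .{{_ : NonZero q}} where

    terms-of : ∀ {n} → Poly n → Subset n → List (ℤ × Vec ℕ n)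
    terms-of p I = filter (λ t → ≡-dec B._≟_ (mlMon (proj₂ t)) I) p

    coeff-support : ∀ {n} (p : Poly n) I → coeff q p I ≢ 0 → ∃ λ t → t ∈ₗ p × mlMon (proj₂ t) ≡ I
    coeff-support p I a≢0 with terms-of p I in eq
    ... | [] = contradiction (m*n%n≡0 0 q) a≢0
    ... | t ∷ _ = t , ∈-filter⁻ (λ t → ≡-dec B._≟_ (mlMon (proj₂ t)) I) (subst (t ∈ₗ_) (sym eq) (here refl))

    ∈-copies⁻ : ∀ {A : Set} {x y : A} k → x ∈ₗ replicate k y → x ≡ y × k ≢ 0
    ∈-copies⁻ (suc k) (here refl) = refl , λ ()
    ∈-copies⁻ (suc k) (there x∈) = proj₁ (∈-copies⁻ k x∈) , λ ()

    monOf-tr-support : ∀ {n} (C : Clause n) j {k} → k ∈ monOf q (tr C) j → k ∈ₗ clauseVars C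
    monOf-tr-support C j {k} k∈ = from-copies (∈-concatMap⁻ copies {xs = subsets _} (∈-lookup {xs = Mf q (tr C)} j))
      where
      copies = λ I → replicate (coeff q (tr C) I) I
      from-copies : ∀ {Is} → Any (λ I → monOf q (tr C) j ∈ₗ copies I) Is → k ∈ₗ clauseVars C
      from-copies (there a) = from-copies a
      from-copies {I ∷ _} (here j∈) with ∈-copies⁻ (coeff q (tr C) I) j∈
      ... | mon≡I , a≢0 with coeff-support (tr C) I a≢0
      ...   | t , t∈ , ml≡I = tr-support C t∈ (subst (k ∈_) (trans mon≡I (sym ml≡I)) k∈)

    monOf-tr-degree : ∀ {n} (C : Clause n) j → length (varsOf (monOf q (tr C) j)) ≤ length C
    monOf-tr-degree {n} C j = subst (length (varsOf I) ≤_) (length-map litVar C)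
      (unique-length≤ (varsOf I) (clauseVars C) (filter⁺ (_∈? I) (allFin⁺ n))
         (λ k∈ → monOf-tr-support C j (proj₂ (∈-filter⁻ (_∈? I) {xs = allFin n} k∈))))
      where I = monOf q (tr C) j

    coeff≤ : ∀ {n} (p : Poly n) I → coeff q p I ≤ q * length (terms-of p I)
    coeff≤ p I with terms-of p I
    ... | [] = ℕ.≤-reflexive (trans (m*n%n≡0 0 q) (sym (ℕ.*-zeroʳ q)))
    ... | t ∷ ts = ℕ.≤-trans (ℕ.<⇒≤ (n%ℕd<d (foldr ℤ._+_ (ℤ.+ 0) (map proj₁ (t ∷ ts))) q)) (ℕ.m≤m*n q (suc (length ts)))

    terms-partition : ∀ {n} (p : Poly n) → sum (map (length ∘ terms-of p) (subsets n)) ≡ length p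
    terms-partition {n} [] = sum-0 (subsets n)
      where
      sum-0 : ∀ (Is : List (Subset n)) → sum (map (λ _ → 0) Is) ≡ 0
      sum-0 [] = refl
      sum-0 (_ ∷ Is) = sum-0 Is
    terms-partition {n} (t ∷ p) = begin
      sum (map (length ∘ terms-of (t ∷ p)) (subsets n))                            ≡⟨ sum-cong (subsets n) split ⟩
      sum (map (λ I → indicator I + length (terms-of p I)) (subsets n))            ≡⟨ sum-+ (subsets n) ⟩
      sum (map indicator (subsets n)) + sum (map (length ∘ terms-of p) (subsets n)) ≡⟨ cong₂ _+_ (exactly-one n (mlMon (proj₂ t))) (terms-partition p) ⟩
      suc (length p) ∎
      where
      open ≡-Reasoning
      indicator : Subset n → ℕ
      indicator I = if mlMon (proj₂ t) ≟ᵇ I then 1 else 0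
      split : ∀ I → length (terms-of (t ∷ p) I) ≡ indicator I + length (terms-of p I)
      split I with mlMon (proj₂ t) ≟ᵇ I
      ... | true = refl
      ... | false = refl
      sum-cong : ∀ (Is : List (Subset n)) {f g : Subset n → ℕ} → (∀ I → f I ≡ g I) → sum (map f Is) ≡ sum (map g Is)
      sum-cong [] _ = refl
      sum-cong (I ∷ Is) f≗g = cong₂ _+_ (f≗g I) (sum-cong Is f≗g)
      sum-+ : ∀ (Is : List (Subset n)) → sum (map (λ I → indicator I + length (terms-of p I)) Is) ≡
                                         sum (map indicator Is) + sum (map (length ∘ terms-of p) Is)
      sum-+ [] = refl
      sum-+ (I ∷ Is) = trans (cong (indicator I + length (terms-of p I) +_) (sum-+ Is)) (interchange (indicator I) _ _ _)


    Mf-length : ∀ {n} (p : Poly n) → sizeM q p ≤ q * length p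
    Mf-length {n} p = ℕ.≤-trans (copies≤ (subsets n)) (ℕ.≤-reflexive (cong (q *_) (terms-partition p)))
      where
      copies≤ : ∀ Is → length (concatMap (λ I → replicate (coeff q p I) I) Is) ≤ q * sum (map (length ∘ terms-of p) Is)
      copies≤ [] = z≤n
      copies≤ (I ∷ Is) = begin
        length (replicate (coeff q p I) I ++ concatMap _ Is)       ≡⟨ length-++ (replicate (coeff q p I) I) ⟩
        length (replicate (coeff q p I) I) + length (concatMap _ Is) ≡⟨ cong (_+ _) (length-replicate (coeff q p I)) ⟩
        coeff q p I + length (concatMap _ Is)                       ≤⟨ ℕ.+-mono-≤ (coeff≤ p I) (copies≤ Is) ⟩
        q * length (terms-of p I) + q * sum (map (length ∘ terms-of p) Is) ≡⟨ ℕ.*-distribˡ-+ q _ _ ⟨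
        q * sum (map (length ∘ terms-of p) (I ∷ Is)) ∎
        where open ℕ.≤-Reasoning

  tr-length : ∀ {n} (C : Clause n) → length (tr C) ≤ 2 ^ length C
  tr-length [] = s≤s z≤n
  tr-length (pos k ∷ A) = begin
    length (tr A ++ negP (mulVar k (tr A)))                    ≡⟨ length-++ (tr A) ⟩
    length (tr A) + length (negP (mulVar k (tr A)))           ≡⟨ cong (length (tr A) +_) (trans (length-map _ (mulVar k (tr A))) (length-map _ (tr A))) ⟩
    length (tr A) + length (tr A)                             ≤⟨ ℕ.+-mono-≤ (tr-length A) (ℕ.≤-trans (ℕ.m≤m+n (length (tr A)) 0) (ℕ.+-monoˡ-≤ 0 (tr-length A))) ⟩
    2 ^ length A + (2 ^ length A + 0)                         ∎
    where open ℕ.≤-Reasoning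
  tr-length (neg k ∷ A) = subst (_≤ 2 ^ suc (length A)) (sym (length-map _ (tr A))) (ℕ.≤-trans (tr-length A) (ℕ.m≤m+n _ _))

module Subsets where

  open import Data.Nat using (suc)
  open import Data.Fin using (Fin; zero; suc)
  open import Data.Bool using (true; false)
  open import Data.Fin.Subset using (Subset; ∣_∣; _∈_; _∉_; ⁅_⁆; ⊥; inside; outside; _∪_)
  open import Data.Fin.Subset.Properties using (x∈p∪q⁺; x∈p∪q⁻; x∈⁅x⁆; x∈⁅y⁆⇒x≡y; ∉⊥; ∣⊥∣≡0; ∪-identityˡ)
  open import Data.Vec using ([]; _∷_)
  import Data.Vec as V
  open import Data.List using (List; length; map)
  open Data.List using ([]; _∷_)
  open import Data.List.Membership.Propositional.Properties using (∈-++⁺ˡ; ∈-++⁺ʳ; ∈-map⁺)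
  open import Data.List.Relation.Unary.All as All using ()
  open import Data.List.Relation.Unary.AllPairs using (_∷_)
  open import Data.List.Relation.Unary.Unique.Propositional using (Unique)
  open import Data.List.Relation.Unary.Any using (here; there)
  open import Data.Sum using (inj₁; inj₂)
  open import Relation.Nullary using (contradiction)
  open import Relation.Binary.PropositionalEquality

  toSubset : ∀ {m} → List (Fin m) → Subset m
  toSubset [] = ⊥
  toSubset (x ∷ xs) = ⁅ x ⁆ ∪ toSubset xs

  ∈-toSubset⁺ : ∀ {m} {x : Fin m} {xs} → x ∈ₗ xs → x ∈ toSubset xs
  ∈-toSubset⁺ {x = x} (here refl) = x∈p∪q⁺ (inj₁ (x∈⁅x⁆ x))
  ∈-toSubset⁺ (there x∈) = x∈p∪q⁺ (inj₂ (∈-toSubset⁺ x∈))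

  ∈-toSubset⁻ : ∀ {m} {x : Fin m} xs → x ∈ toSubset xs → x ∈ₗ xs
  ∈-toSubset⁻ [] x∈ = contradiction x∈ ∉⊥
  ∈-toSubset⁻ (y ∷ xs) x∈ with x∈p∪q⁻ ⁅ y ⁆ (toSubset xs) x∈
  ... | inj₁ x∈y = here (x∈⁅y⁆⇒x≡y y x∈y)
  ... | inj₂ x∈xs = there (∈-toSubset⁻ xs x∈xs)

  ∣⁅x⁆∪p∣ : ∀ {m} (x : Fin m) p → x ∉ p → ∣ ⁅ x ⁆ ∪ p ∣ ≡ suc ∣ p ∣
  ∣⁅x⁆∪p∣ zero (inside ∷ p) x∉p = contradiction V.here x∉p
  ∣⁅x⁆∪p∣ zero (outside ∷ p) x∉p = cong (suc ∘′ ∣_∣) (∪-identityˡ p)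
    where open import Function using (_∘′_)
  ∣⁅x⁆∪p∣ (suc x) (inside ∷ p) x∉p = cong suc (∣⁅x⁆∪p∣ x p (λ x∈p → x∉p (V.there x∈p)))
  ∣⁅x⁆∪p∣ (suc x) (outside ∷ p) x∉p = ∣⁅x⁆∪p∣ x p (λ x∈p → x∉p (V.there x∈p))

  ∣toSubset∣ : ∀ {m} (xs : List (Fin m)) → Unique xs → ∣ toSubset xs ∣ ≡ length xs
  ∣toSubset∣ {m} [] _ = ∣⊥∣≡0 m
  ∣toSubset∣ (x ∷ xs) (x∉ ∷ u) =
    trans (∣⁅x⁆∪p∣ x (toSubset xs) (λ x∈ → All.lookup x∉ (∈-toSubset⁻ xs x∈) refl)) (cong suc (∣toSubset∣ xs u))

  ∈-subsets : ∀ {m} (E : Subset m) → E ∈ₗ subsets m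
  ∈-subsets [] = here refl
  ∈-subsets {suc m} (false ∷ E) = ∈-++⁺ˡ (∈-map⁺ (false ∷_) (∈-subsets E))
  ∈-subsets {suc m} (true ∷ E) = ∈-++⁺ʳ (map (false ∷_) (subsets m)) (∈-map⁺ (true ∷_) (∈-subsets E))

module Monomials where

  open import Data.Nat using (zero; suc)
  open import Data.Bool using (Bool; true; false; not; _∨_; _∧_)
  open import Data.Bool.Properties using (⇔→≡)
  open import Data.Fin using (Fin; zero; suc)
  open import Data.Fin.Subset using (Subset; _∈_; inside; outside)
  open import Data.Fin.Subset.Properties using (_∈?_)
  open import Data.Vec using ([]; _∷_)
  import Data.Vec as V
  open import Data.List using (map; allFin)
  open import Data.List.Membership.Propositional.Properties using (∈-map⁺; ∈-map⁻; ∈-filter⁺; ∈-filter⁻; ∈-allFin)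
  open import Data.Product using (_,_; proj₂)
  open import Function using (_∘_; mk⇔)
  open import Relation.Binary.PropositionalEquality
  open Semantics
  open Counting using (holds)

  holds-true⁻ : ∀ {n} (α : Assignment n) I → holds α I ≡ true → ∀ {k} → k ∈ I → α k ≡ true
  holds-true⁻ α (inside ∷ I) αI V.here with α zero
  ... | true = refl
  holds-true⁻ α (b ∷ I) αI (V.there k∈I) with not b ∨ α zero
  ... | true = holds-true⁻ (α ∘ suc) I αI k∈I

  holds-true⁺ : ∀ {n} (α : Assignment n) I → (∀ {k} → k ∈ I → α k ≡ true) → holds α I ≡ true
  holds-true⁺ α [] _ = refl
  holds-true⁺ α (inside ∷ I) αI rewrite αI V.here = holds-true⁺ (α ∘ suc) I (αI ∘ V.there)
  holds-true⁺ α (outside ∷ I) αI = holds-true⁺ (α ∘ suc) I (αI ∘ V.there)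

  holds-local : ∀ {n} (α β : Assignment n) I → (∀ {k} → k ∈ I → α k ≡ β k) → holds α I ≡ holds β I
  holds-local α β [] _ = refl
  holds-local α β (inside ∷ I) α≗β =
    cong₂ (λ a b → (false ∨ a) ∧ b) (α≗β V.here) (holds-local (α ∘ suc) (β ∘ suc) I (α≗β ∘ V.there))
  holds-local α β (outside ∷ I) α≗β = holds-local (α ∘ suc) (β ∘ suc) I (α≗β ∘ V.there)

  ∈-varsOf⁻ : ∀ {n} (I : Subset n) {k} → k ∈ₗ varsOf I → k ∈ I
  ∈-varsOf⁻ {n} I k∈ = proj₂ (∈-filter⁻ (_∈? I) {xs = allFin n} k∈)

  ∈-varsOf⁺ : ∀ {n} (I : Subset n) {k} → k ∈ I → k ∈ₗ varsOf I
  ∈-varsOf⁺ I k∈ = ∈-filter⁺ (_∈? I) (∈-allFin _) k∈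

  eval-conjVars : ∀ {n} (α : Assignment n) I → eval α (conjVars I) ≡ holds α I
  eval-conjVars α I = ⇔→≡ (mk⇔ to from)
    where
    to : eval α (conjVars I) ≡ true → holds α I ≡ true
    to αI = holds-true⁺ α I (λ k∈I → eval-⋀⁻ α (map var (varsOf I)) αI (∈-map⁺ var (∈-varsOf⁺ I k∈I)))
    from : holds α I ≡ true → eval α (conjVars I) ≡ true
    from αI = eval-⋀⁺ α (map var (varsOf I)) var-true
      where
      var-true : ∀ {B} → B ∈ₗ map var (varsOf I) → eval α B ≡ true
      var-true B∈ with ∈-map⁻ var B∈
      ... | k , k∈ , refl = holds-true⁻ α I αI (∈-varsOf⁻ I k∈)

module Partition (q : ℕ) .{{_ : NonZero q}} {n : ℕ} (C : Clause n) where

  open import Data.Nat.Properties using (m≤m*n)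
  open import Data.Bool using (Bool; true)
  open import Data.Bool.Properties using (⇔→≡)
  import Data.Bool as B
  open import Data.Fin using (Fin)
  open import Data.Fin.Subset using (Subset; ∣_∣; _∈_)
  open import Data.Vec.Properties using (≡-dec)
  open import Data.List using (List; map; length; allFin; filterᵇ; concat)
  open import Data.List.Membership.Propositional.Properties using (∈-map⁺; ∈-map⁻; ∈-allFin; ∈-concat⁺′; ∈-concat⁻′)
  open import Data.List.Relation.Unary.Unique.Propositional using (Unique)
  open import Data.List.Relation.Unary.Unique.Propositional.Properties using (allFin⁺; filter⁺)
  open import Data.Product using (∃; _×_; _,_; proj₂)
  open import Data.Sum using (inj₁; inj₂)
  open import Function using (_∘_; mk⇔)
  open import Relation.Nullary using (yes; does; contradiction)
  open import Relation.Nullary.Decidable using (dec-true; T?)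
  open import Relation.Binary.PropositionalEquality
  open Semantics
  open Contexts
  open ListFacts
  open Counting using (holds; tr-vanishes; satisfied-copies; length-filterᵇ-lookup)
  open Support using (clauseVars; monOf-tr-support)
  open Subsets
  open Monomials

  p : Poly n
  p = tr C

  m : ℕ
  m = sizeM q p

  open import Data.List.Membership.DecPropositional (≡-dec {n = m} B._≟_) using (_∈?_)

  satisfied : Assignment n → Fin m → Bool
  satisfied α j = holds α (monOf q p j)

  satisfiedIndices : Assignment n → List (Fin m)
  satisfiedIndices α = filterᵇ (satisfied α) (allFin m)

  blockLists : Assignment n → List (List (Fin m))
  blockLists α = chunks q (length (satisfiedIndices α)) (satisfiedIndices α)

  isBlock : Assignment n → Subset m → Bool
  isBlock α E = does (E ∈? map toSubset (blockLists α))

  θ : Subset m → Form n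
  θ E = ⋁ (map conjLits (filterᵇ (λ σ → isBlock (assignmentOf σ) E) (contexts (clauseVars C))))

  concat-blockLists : ∀ α → concat (blockLists α) ≡ satisfiedIndices α
  concat-blockLists α = concat-chunks q (length (satisfiedIndices α)) (satisfiedIndices α) (m≤m*n _ q)

  unique-blockLists : ∀ α → Unique (concat (blockLists α))
  unique-blockLists α = subst Unique (sym (concat-blockLists α)) (filter⁺ (T? ∘ satisfied α) (allFin⁺ m))

  isBlock⁻ : ∀ α E → isBlock α E ≡ true → ∃ λ c → c ∈ₗ blockLists α × E ≡ toSubset c
  isBlock⁻ α E E-block with E ∈? map toSubset (blockLists α) | E-block
  ... | yes E∈ | _ = ∈-map⁻ toSubset E∈

  block-satisfied : ∀ α E j → isBlock α E ≡ true → j ∈ E → satisfied α j ≡ true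
  block-satisfied α E j E-block j∈E with isBlock⁻ α E E-block
  ... | c , c∈ , refl =
    proj₂ (∈-filterᵇ⁻ (satisfied α) {xs = allFin m} (subst (j ∈ₗ_) (concat-blockLists α) (∈-concat⁺′ (∈-toSubset⁻ c j∈E) c∈)))

  blocks-disjoint : ∀ α E F j → isBlock α E ≡ true → isBlock α F ≡ true → j ∈ E → j ∈ F → E ≡ F
  blocks-disjoint α E F j E-block F-block j∈E j∈F with isBlock⁻ α E E-block | isBlock⁻ α F F-block
  ... | c , c∈ , refl | c' , c'∈ , refl =
    cong toSubset (same-chunk (blockLists α) (unique-blockLists α) (∈-toSubset⁻ c j∈E) c∈ (∈-toSubset⁻ c' j∈F) c'∈)

  -- Since tr C vanishes at α, the number of satisfied copies is a multiple of q,
  -- so the groups are all full.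
  block-covers : ∀ α → ClauseSat α C → ∀ j → satisfied α j ≡ true →
                 ∃ λ E → isBlock α E ≡ true × ∣ E ∣ ≡ q × j ∈ E
  block-covers α sat j j-sat
    with t , count ← satisfied-copies q α p (tr-vanishes α C sat)
    with c , j∈c , c∈ ← ∈-concat⁻′ (blockLists α) (subst (j ∈ₗ_) (sym (concat-blockLists α)) (∈-filterᵇ⁺ (satisfied α) (∈-allFin j) j-sat))
    with chunk-length q _ t (satisfiedIndices α) (trans (length-filterᵇ-lookup (holds α) (Mf q p)) count) c∈
  ... | inj₁ refl = contradiction j∈c λ ()
  ... | inj₂ c-length =
    toSubset c , dec-true (toSubset c ∈? map toSubset (blockLists α)) (∈-map⁺ toSubset c∈) ,
    trans (∣toSubset∣ c (unique-concat (blockLists α) (unique-blockLists α) c∈)) c-length , ∈-toSubset⁺ j∈c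

  isBlock-local : ∀ α β E → (∀ {k} → k ∈ₗ clauseVars C → α k ≡ β k) → isBlock α E ≡ isBlock β E
  isBlock-local α β E α≗β =
    cong (λ (L : List (Fin m)) → does (E ∈? map toSubset (chunks q (length L) L))) (filterᵇ-cong (satisfied α) (satisfied β) (allFin m) same-satisfied)
    where
    same-satisfied : ∀ j → satisfied α j ≡ satisfied β j
    same-satisfied j = holds-local α β (monOf q p j) (α≗β ∘ monOf-tr-support q C j)

  eval-θ : ∀ α E → eval α (θ E) ≡ isBlock α E
  eval-θ α E = ⇔→≡ (mk⇔ to from)
    where
    Vc = clauseVars C
    P : Context → Bool
    P σ = isBlock (assignmentOf σ) E
    agrees : ∀ {σ} → σ ∈ₗ contexts Vc → eval α (conjLits σ) ≡ true → ∀ {k} → k ∈ₗ Vc → α k ≡ assignmentOf σ k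
    agrees {σ} σ∈ ασ k∈ = conjLits-agrees α σ ασ (subst (_ ∈ₗ_) (sym (contexts-domain Vc σ∈)) k∈)
    to : eval α (θ E) ≡ true → isBlock α E ≡ true
    to αθ =
      let B , B∈ , αB = evalAny-true⁻ α (map conjLits (filterᵇ P (contexts Vc))) αθ
          σ , σ∈ , B≡ = ∈-map⁻ conjLits B∈
          σ∈Vc , Pσ = ∈-filterᵇ⁻ P σ∈
      in trans (isBlock-local α (assignmentOf σ) E (agrees σ∈Vc (subst (λ B → eval α B ≡ true) B≡ αB))) Pσ
    from : isBlock α E ≡ true → eval α (θ E) ≡ true
    from E-block = evalAny-true⁺ α (∈-map⁺ conjLits (∈-filterᵇ⁺ P σ∈ Pσ)) (restrict-satisfies α Vc)
      where
      σ∈ = restrict∈contexts α Vc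
      Pσ : P (restrict α Vc) ≡ true
      Pσ = trans (sym (isBlock-local α _ E (agrees σ∈ (restrict-satisfies α Vc)))) E-block

module FormulaSizes where

  open import Data.Nat using (zero; suc; _+_; _*_; _^_; _≤_; _≟_; z≤n; s≤s)
  open import Data.Nat.Properties
  open import Data.Bool using (true; false)
  open import Data.Fin using (Fin)
  open import Data.Fin.Subset using (Subset; ∣_∣)
  open import Data.Vec using (_∷_)
  open import Data.List using (List; []; _∷_; _++_; map; length; filter)
  open import Data.List.Properties using (length-map; length-++; map-∘; filter-++; filter-≐)
  open import Data.List.Relation.Unary.All using (All)
  open import Data.List.Membership.Propositional using (_∈_)
  open import Data.Product using (_,_)
  open import Relation.Nullary using (does; yes; no; contradiction)
  open import Relation.Unary using (Pred; Decidable)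
  open import Level using (0ℓ)
  open import Relation.Binary.PropositionalEquality
  import Function
  open Semantics
  open Contexts

  size-conjLits : ∀ {n} (σ : Context {n}) → size (conjLits σ) ≤ 2 + 3 * length σ
  size-conjLits σ = s≤s (s≤s (≤-trans (≤-reflexive (cong sizes (sym (map-∘ σ))))
                                      (≤-trans (sizes-map≤ _ σ lit≤) (≤-reflexive (*-comm (length σ) 3)))))
    where
    lit≤ : ∀ {x} → x ∈ σ → size (¬f (trueLit x)) ≤ 3
    lit≤ {v , true} _ = s≤s (s≤s z≤n)
    lit≤ {v , false} _ = ≤-refl

  depth-conjLits : ∀ {n} (σ : Context {n}) → depth (conjLits σ) ≤ 4
  depth-conjLits σ = s≤s (depth-⋁ (subst (All (λ B → depth B ≤ 2)) (map-∘ σ) (depths-map≤ _ σ lit≤)))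
    where
    lit≤ : ∀ {x} → x ∈ σ → depth (¬f (trueLit x)) ≤ 2
    lit≤ {v , true} _ = s≤s z≤n
    lit≤ {v , false} _ = ≤-refl

  size-conjVars : ∀ {n} (I : Subset n) → size (conjVars I) ≤ 2 + 2 * length (varsOf I)
  size-conjVars I = s≤s (s≤s (≤-trans (≤-reflexive (cong sizes (sym (map-∘ vs))))
                                      (≤-trans (sizes-map≤ _ vs (λ _ → ≤-refl)) (≤-reflexive (*-comm (length vs) 2)))))
    where vs = varsOf I

  depth-conjVars : ∀ {n} (I : Subset n) → depth (conjVars I) ≤ 3
  depth-conjVars I = s≤s (depth-⋁ (subst (All (λ B → depth B ≤ 1)) (map-∘ (varsOf I)) (depths-map≤ _ (varsOf I) (λ _ → ≤-refl))))

  size-clauseForm : ∀ {n} (C : Clause n) → size (clauseForm C) ≤ 1 + 2 * length C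
  size-clauseForm C = s≤s (≤-trans (sizes-map≤ litForm C lit≤) (≤-reflexive (*-comm (length C) 2)))
    where
    lit≤ : ∀ {l} → l ∈ C → size (litForm l) ≤ 2
    lit≤ {pos k} _ = s≤s z≤n
    lit≤ {neg k} _ = ≤-refl

  depth-clauseForm : ∀ {n} (C : Clause n) → depth (clauseForm C) ≤ 2
  depth-clauseForm C = depth-⋁ (depths-map≤ litForm C lit≤)
    where
    lit≤ : ∀ {l} → l ∈ C → depth (litForm l) ≤ 1
    lit≤ {pos k} _ = z≤n
    lit≤ {neg k} _ = ≤-refl

  length-contexts : ∀ {n} (W : List (Fin n)) → length (contexts W) ≡ 2 ^ length W
  length-contexts [] = refl
  length-contexts (v ∷ W) = begin
    length (map _ (contexts W) ++ map _ (contexts W))  ≡⟨ length-++ (map ((v , true) ∷_) (contexts W)) ⟩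
    length (map _ (contexts W)) + length (map _ (contexts W)) ≡⟨ cong₂ _+_ (length-map _ (contexts W)) (length-map _ (contexts W)) ⟩
    length (contexts W) + length (contexts W)          ≡⟨ cong₂ _+_ (length-contexts W) (trans (length-contexts W) (sym (+-identityʳ _))) ⟩
    2 ^ length W + (2 ^ length W + 0)                 ∎
    where open ≡-Reasoning

  module _ {A : Set} where

    length-filter-map : ∀ {B : Set} {P : Pred B 0ℓ} (P? : Decidable P) (f : A → B) xs →
                        length (filter P? (map f xs)) ≡ length (filter (P? Function.∘ f) xs)
    length-filter-map P? f [] = refl
    length-filter-map P? f (x ∷ xs) with does (P? (f x))
    ... | true = cong suc (length-filter-map P? f xs)
    ... | false = length-filter-map P? f xs

    length-filter-mono : ∀ {P Q : Pred A 0ℓ} (P? : Decidable P) (Q? : Decidable Q) → (∀ {x} → P x → Q x) →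
                         ∀ xs → length (filter P? xs) ≤ length (filter Q? xs)
    length-filter-mono P? Q? P⇒Q [] = z≤n
    length-filter-mono P? Q? P⇒Q (x ∷ xs) with P? x | Q? x
    ... | yes _ | yes _ = s≤s (length-filter-mono P? Q? P⇒Q xs)
    ... | yes Px | no ¬Qx = contradiction (P⇒Q Px) ¬Qx
    ... | no _ | yes _ = ≤-trans (length-filter-mono P? Q? P⇒Q xs) (n≤1+n _)
    ... | no _ | no _ = length-filter-mono P? Q? P⇒Q xs

  count-subsets : ∀ m k → length (filter (λ E → ∣ E ∣ ≟ k) (subsets m)) ≤ suc m ^ k
  count-subsets zero zero = ≤-refl
  count-subsets zero (suc k) = z≤n
  count-subsets (suc m) k = begin
    length (filter (λ E → ∣ E ∣ ≟ k) (map (false ∷_) S ++ map (true ∷_) S))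
      ≡⟨ cong length (filter-++ (λ E → ∣ E ∣ ≟ k) (map (false ∷_) S) _) ⟩
    length (filter (λ E → ∣ E ∣ ≟ k) (map (false ∷_) S) ++ filter (λ E → ∣ E ∣ ≟ k) (map (true ∷_) S))
      ≡⟨ length-++ (filter (λ E → ∣ E ∣ ≟ k) (map (false ∷_) S)) ⟩
    length (filter (λ E → ∣ E ∣ ≟ k) (map (false ∷_) S)) + length (filter (λ E → ∣ E ∣ ≟ k) (map (true ∷_) S))
      ≡⟨ cong₂ _+_ (length-filter-map (λ E → ∣ E ∣ ≟ k) (false ∷_) S) (length-filter-map (λ E → ∣ E ∣ ≟ k) (true ∷_) S) ⟩
    length (filter (λ E → ∣ E ∣ ≟ k) S) + length (filter (λ E → suc ∣ E ∣ ≟ k) S)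
      ≤⟨ split k ⟩
    suc (suc m) ^ k ∎
    where
    open ≤-Reasoning
    S = subsets m
    none : ∀ (Es : List (Subset m)) → length (filter (λ E → suc ∣ E ∣ ≟ 0) Es) ≡ 0
    none [] = refl
    none (_ ∷ Es) = none Es
    split : ∀ k → length (filter (λ E → ∣ E ∣ ≟ k) S) + length (filter (λ E → suc ∣ E ∣ ≟ k) S) ≤ suc (suc m) ^ k
    split zero = ≤-trans (≤-reflexive (trans (cong (length (filter (λ E → ∣ E ∣ ≟ 0) S) +_) (none S)) (+-identityʳ _))) (count-subsets m 0)
    split (suc k) = begin
      length (filter (λ E → ∣ E ∣ ≟ suc k) S) + length (filter (λ E → suc ∣ E ∣ ≟ suc k) S)
        ≡⟨ cong (λ L → length (filter (λ E → ∣ E ∣ ≟ suc k) S) + length L)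
                (filter-≐ (λ E → suc ∣ E ∣ ≟ suc k) (λ E → ∣ E ∣ ≟ k) (suc-injective , cong suc) S) ⟩
      length (filter (λ E → ∣ E ∣ ≟ suc k) S) + length (filter (λ E → ∣ E ∣ ≟ k) S)
        ≤⟨ +-mono-≤ (count-subsets m (suc k)) (count-subsets m k) ⟩
      suc m * suc m ^ k + suc m ^ k ≡⟨ +-comm (suc m * suc m ^ k) _ ⟩
      suc (suc m) * suc m ^ k        ≤⟨ *-monoʳ-≤ (suc (suc m)) (^-monoˡ-≤ k (n≤1+n (suc m))) ⟩
      suc (suc m) ^ suc k ∎

module ClauseStatements {n : ℕ} where

  open import Data.Bool using (true; false; not)
  open import Data.Fin using (Fin)
  open import Data.Fin.Subset using (_∈_)
  open import Data.List using (List; map)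
  open import Data.List.Membership.Propositional using (lose)
  open import Data.List.Membership.Propositional.Properties using (∈-map⁺; ∈-map⁻)
  open import Data.Product using (_,_; proj₁)
  open import Relation.Binary.PropositionalEquality
  open Semantics
  open Contexts
  open Support using (litVar; clauseVars)
  open Monomials using (∈-varsOf⁻)

  usesOnly-conjLits : ∀ {V : List (Fin n)} σ → map proj₁ σ ≡ V → UsesOnly V (conjLits σ)
  usesOnly-conjLits {V} σ dom = allUseOnly (map ¬f (map trueLit σ)) lit
    where
    lit : ∀ {B} → B ∈ₗ map ¬f (map trueLit σ) → UsesOnly V B
    lit B∈ with ∈-map⁻ ¬f B∈
    ... | _ , x∈ , refl with ∈-map⁻ trueLit x∈
    ...   | (v , true) , v∈ , refl = subst (v ∈ₗ_) dom (∈-map⁺ proj₁ v∈)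
    ...   | (v , false) , v∈ , refl = subst (v ∈ₗ_) dom (∈-map⁺ proj₁ v∈)

  usesOnly-conjVars : ∀ {V : List (Fin n)} I → (∀ {k} → k ∈ I → k ∈ₗ V) → UsesOnly V (conjVars I)
  usesOnly-conjVars {V} I I⊆V = allUseOnly (map ¬f (map var (varsOf I))) lit
    where
    lit : ∀ {B} → B ∈ₗ map ¬f (map var (varsOf I)) → UsesOnly V B
    lit B∈ with ∈-map⁻ ¬f B∈
    ... | _ , x∈ , refl with ∈-map⁻ var x∈
    ...   | k , k∈ , refl = I⊆V (∈-varsOf⁻ I k∈)

  usesOnly-clauseForm : ∀ (C : Clause n) → UsesOnly (clauseVars C) (clauseForm C)
  usesOnly-clauseForm C = allUseOnly (map litForm C) lit
    where
    lit : ∀ {B} → B ∈ₗ map litForm C → UsesOnly (clauseVars C) B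
    lit B∈ with ∈-map⁻ litForm B∈
    ... | pos k , l∈ , refl = ∈-map⁺ litVar l∈
    ... | neg k , l∈ , refl = ∈-map⁺ litVar l∈

  eval-clauseForm : ∀ (α : Assignment n) C → eval α (clauseForm C) ≡ true → ClauseSat α C
  eval-clauseForm α C αC with evalAny-true⁻ α (map litForm C) αC
  ... | B , B∈ , αB with ∈-map⁻ litForm B∈
  ...   | pos k , l∈ , refl = lose l∈ αB
  ...   | neg k , l∈ , refl = lose l∈ (not-true (α k) αB)
    where
    not-true : ∀ b → not b ≡ true → b ≡ false
    not-true false _ = refl

module ClauseReduction (q : ℕ) .{{_ : NonZero q}} {n : ℕ} (H : List (Form n)) (C : Clause n)
                       (C∈H : clauseForm C ∈ₗ H) where

  open import Data.Nat using (suc; _+_; _*_; _^_; _≤_; _≟_; s≤s)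
  open import Data.Nat.Properties
  open import Data.Nat.Tactic.RingSolver using (solve-∀)
  open import Data.Bool using (true; false)
  import Data.Bool as B
  open import Data.Fin using (Fin)
  open import Data.Fin.Subset using (Subset; ∣_∣; _∈_; _∩_; Nonempty)
  open import Data.Fin.Subset.Properties using (x∈p∩q⁻; nonempty?) renaming (_∈?_ to _∈ˢ?_)
  open import Data.Vec.Properties using (≡-dec)
  open import Data.List using (List; []; _∷_; _++_; map; length; filter; filterᵇ; concatMap; allFin)
  open import Data.List.Properties using (length-map; length-filter)
  open import Data.List.Relation.Unary.All using (All; []; _∷_)
  open import Data.List.Membership.Propositional using (find; lose)
  open import Data.List.Membership.Propositional.Properties
    using (∈-++⁺ˡ; ∈-++⁺ʳ; ∈-++⁻; ∈-map⁺; ∈-map⁻; ∈-filter⁺; ∈-filter⁻; ∈-concatMap⁺; ∈-concatMap⁻; ∈-allFin)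
  open import Data.Product using (∃; _×_; _,_; proj₁; proj₂)
  open import Data.Sum using ([_,_]′)
  open import Function using (_∘_)
  open import Relation.Nullary using (Dec; ¬?; _×-dec_)
  open import Relation.Binary.PropositionalEquality
  open Semantics
  open Contexts
  open Derivations H
  open ListFacts using (∈-filterᵇ⁻)
  open Support using (clauseVars; monOf-tr-support; monOf-tr-degree)
  open Subsets using (∈-subsets)
  open Monomials using (eval-conjVars)
  open Partition q C
  open FormulaSizes
  open ClauseStatements

  h : Form n
  h = clauseForm C

  ℓ : ℕ
  ℓ = length C

  qSets : List (Subset m)
  qSets = filter (λ E → ∣ E ∣ ≟ q) (subsets m)

  -- Sb bounds the size of every θ_E and every monomial, and Z that of every statement below.
  Qn R Sb Z : ℕ
  Qn = length qSets
  R = (2 + 3 * ℓ) * 2 ^ ℓ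
  Sb = 3 + R
  Z = Sb * (Qn + 3)

  open Completeness H (clauseVars C) Z 7

  implication : Subset m → Fin m → Form n
  implication E j = θ E ⇒ conjVars (monOf q p j)

  exclusion : Subset m → Subset m → Form n
  exclusion E F = ⋁ (¬f (θ E) ∷ ¬f (θ F) ∷ [])

  coverage : Fin m → Form n
  coverage j = conjVars (monOf q p j) ⇒ ⋁ (map θ (qSetsContaining q p j))

  overlapping? : ∀ (E F : Subset m) → Dec (E ≢ F × Nonempty (E ∩ F))
  overlapping? E F = ¬? (≡-dec B._≟_ E F) ×-dec nonempty? (E ∩ F)

  implicationsOf exclusionsOf : Subset m → List (Form n)
  implicationsOf E = map (implication E) (filter (_∈ˢ? E) (allFin m))
  exclusionsOf E = map (exclusion E) (filter (overlapping? E) qSets)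

  implications exclusions coverages statements : List (Form n)
  implications = concatMap implicationsOf qSets
  exclusions = concatMap exclusionsOf qSets
  coverages = map coverage (allFin m)
  statements = implications ++ exclusions ++ coverages

  Vc : List (Fin n)
  Vc = clauseVars C

  length-Vc : length Vc ≡ ℓ
  length-Vc = length-map _ C

  2+3ℓ≤R : 2 + 3 * ℓ ≤ R
  2+3ℓ≤R = m≤m*n (2 + 3 * ℓ) (2 ^ ℓ) {{m^n≢0 2 ℓ}}

  size-θ : ∀ E → size (θ E) ≤ Sb
  size-θ E = s≤s (begin
    sizes (map conjLits L)
      ≤⟨ sizes-map≤ conjLits L (λ {σ} σ∈ → ≤-trans (size-conjLits σ) (≤-reflexive (cong (λ l → 2 + 3 * l) (length-context σ∈)))) ⟩
    length L * (2 + 3 * ℓ)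
      ≤⟨ *-monoˡ-≤ (2 + 3 * ℓ) (≤-trans (length-filter _ (contexts Vc)) (≤-reflexive (trans (length-contexts Vc) (cong (2 ^_) length-Vc)))) ⟩
    2 ^ ℓ * (2 + 3 * ℓ)      ≡⟨ *-comm (2 ^ ℓ) _ ⟩
    R                        ≤⟨ m≤n+m R 2 ⟩
    2 + R                    ∎)
    where
    open ≤-Reasoning
    L = filterᵇ (λ σ → isBlock (assignmentOf σ) E) (contexts Vc)
    length-context : ∀ {σ} → σ ∈ₗ L → length σ ≡ ℓ
    length-context {σ} σ∈ =
      trans (sym (length-map proj₁ σ)) (trans (cong length (contexts-domain Vc (proj₁ (∈-filterᵇ⁻ _ σ∈)))) length-Vc)

  depth-θ : ∀ E → depth (θ E) ≤ 5
  depth-θ E = depth-⋁ (depths-map≤ conjLits (filterᵇ (λ σ → isBlock (assignmentOf σ) E) (contexts Vc)) (λ {σ} _ → depth-conjLits σ))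

  size-monomial : ∀ j → size (conjVars (monOf q p j)) ≤ Sb
  size-monomial j = begin
    size (conjVars (monOf q p j)) ≤⟨ size-conjVars (monOf q p j) ⟩
    2 + 2 * length (varsOf (monOf q p j)) ≤⟨ +-monoʳ-≤ 2 (*-monoʳ-≤ 2 (monOf-tr-degree q C j)) ⟩
    2 + 2 * ℓ ≤⟨ +-monoʳ-≤ 2 (≤-trans (*-monoˡ-≤ ℓ (n≤1+n 2)) (≤-trans (m≤n+m (3 * ℓ) 2) 2+3ℓ≤R)) ⟩
    2 + R ≤⟨ n≤1+n _ ⟩
    Sb ∎
    where open ≤-Reasoning

  within-Z : ∀ {φ} → size φ ≤ 3 + 2 * Sb + Qn * Sb → depth φ ≤ 7 → Within 𝕫 0 φ
  within-Z {φ} sφ dφ =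
    within (subst (size φ ≤_) (sym ⟦𝕫⟧) (≤-trans sφ (≤-trans (+-monoˡ-≤ (Qn * Sb) (+-monoˡ-≤ (2 * Sb) (m≤m+n 3 R)))
                                                   (≤-reflexive (regroup Sb Qn)))))
           (≤-trans dφ (≤-reflexive (sym (+-identityʳ 7))))
    where
    regroup : ∀ s k → s + 2 * s + k * s ≡ s * (k + 3)
    regroup = solve-∀

  within-implication : ∀ E j → Within 𝕫 0 (implication E j)
  within-implication E j =
    within-Z (≤-trans (s≤s (+-mono-≤ (s≤s (size-θ E)) (+-monoˡ-≤ 0 (size-monomial j))))
                      (≤-trans (≤-reflexive (shape Sb)) (≤-trans (n≤1+n _) (m≤m+n (3 + 2 * Sb) (Qn * Sb)))))
             (depth-⋁ {Γ = ¬f (θ E) ∷ conjVars (monOf q p j) ∷ []} (s≤s (depth-θ E) ∷ ≤-trans (depth-conjVars (monOf q p j)) (m≤m+n 3 3) ∷ []))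
    where
    shape : ∀ s → suc (suc s + (s + 0)) ≡ 2 + 2 * s
    shape = solve-∀

  within-exclusion : ∀ E F → Within 𝕫 0 (exclusion E F)
  within-exclusion E F =
    within-Z (≤-trans (s≤s (+-mono-≤ (s≤s (size-θ E)) (+-monoˡ-≤ 0 (s≤s (size-θ F)))))
                      (≤-trans (≤-reflexive (shape Sb)) (m≤m+n (3 + 2 * Sb) (Qn * Sb))))
             (depth-⋁ {Γ = ¬f (θ E) ∷ ¬f (θ F) ∷ []} (s≤s (depth-θ E) ∷ s≤s (depth-θ F) ∷ []))
    where
    shape : ∀ s → suc (suc s + (suc s + 0)) ≡ 3 + 2 * s
    shape = solve-∀

  length-qSetsContaining : ∀ j → length (qSetsContaining q p j) ≤ Qn
  length-qSetsContaining j = length-filter-mono _ (λ E → ∣ E ∣ ≟ q) proj₁ (subsets m)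

  within-coverage : ∀ j → Within 𝕫 0 (coverage j)
  within-coverage j =
    within-Z (≤-trans (s≤s (+-mono-≤ (s≤s (size-monomial j)) (+-monoˡ-≤ 0 (s≤s θs≤))))
                      (≤-trans (≤-reflexive (shape Sb (Qn * Sb))) (+-monoˡ-≤ (Qn * Sb) (+-monoʳ-≤ 3 (m≤m+n Sb (Sb + 0))))))
             (depth-⋁ {Γ = ¬f (conjVars (monOf q p j)) ∷ ⋁ (map θ Es) ∷ []}
               (≤-trans (s≤s (depth-conjVars (monOf q p j))) (m≤m+n 4 2) ∷ depth-⋁ (depths-map≤ θ Es (λ {E} _ → depth-θ E)) ∷ []))
    where
    Es = qSetsContaining q p j
    θs≤ : sizes (map θ Es) ≤ Qn * Sb
    θs≤ = ≤-trans (sizes-map≤ θ Es (λ {E} _ → size-θ E)) (*-monoˡ-≤ Sb (length-qSetsContaining j))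
    shape : ∀ s t → suc (suc s + (suc t + 0)) ≡ 3 + s + t
    shape = solve-∀

  within-h : Within 𝕫 0 h
  within-h = within-Z (≤-trans (size-clauseForm C) h≤) (≤-trans (depth-clauseForm C) (m≤m+n 2 5))
    where
    h≤ : 1 + 2 * ℓ ≤ 3 + 2 * Sb + Qn * Sb
    h≤ = ≤-trans (s≤s (≤-trans (*-monoˡ-≤ ℓ (n≤1+n 2)) (≤-trans (m≤n+m (3 * ℓ) 2) 2+3ℓ≤R)))
                 (≤-trans (≤-trans (m≤n+m (suc R) 2) (≤-trans (m≤m+n Sb (Sb + 0)) (m≤n+m (2 * Sb) 3))) (m≤m+n (3 + 2 * Sb) (Qn * Sb)))

  usesOnly-θ : ∀ E → UsesOnly Vc (θ E)
  usesOnly-θ E = allUseOnly _ context-conj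
    where
    context-conj : ∀ {B} → B ∈ₗ map conjLits (filterᵇ (λ σ → isBlock (assignmentOf σ) E) (contexts Vc)) → UsesOnly Vc B
    context-conj B∈ =
      let σ , σ∈ , B≡ = ∈-map⁻ conjLits B∈
      in subst (UsesOnly Vc) (sym B≡) (usesOnly-conjLits σ (contexts-domain Vc (proj₁ (∈-filterᵇ⁻ _ σ∈))))

  usesOnly-monomial : ∀ j → UsesOnly Vc (conjVars (monOf q p j))
  usesOnly-monomial j = usesOnly-conjVars (monOf q p j) (monOf-tr-support q C j)

  valid-implication : ∀ E j → j ∈ E → ∀ α → eval α h ≡ true → eval α (implication E j) ≡ true
  valid-implication E j j∈E α _ = eval-⇒ α (θ E) (conjVars (monOf q p j)) λ αθ →
    trans (eval-conjVars α (monOf q p j)) (block-satisfied α E j (trans (sym (eval-θ α E)) αθ) j∈E)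

  valid-exclusion : ∀ E F → E ≢ F → Nonempty (E ∩ F) → ∀ α → eval α h ≡ true → eval α (exclusion E F) ≡ true
  valid-exclusion E F E≢F (j , j∈E∩F) α _ = eval-¬∨¬ α (θ E) (θ F) λ αθE αθF →
    let j∈E , j∈F = x∈p∩q⁻ E F j∈E∩F
    in E≢F (blocks-disjoint α E F j (trans (sym (eval-θ α E)) αθE) (trans (sym (eval-θ α F)) αθF) j∈E j∈F)

  valid-coverage : ∀ j α → eval α h ≡ true → eval α (coverage j) ≡ true
  valid-coverage j α αh = eval-⇒ α (conjVars (monOf q p j)) (⋁ (map θ (qSetsContaining q p j))) covered
    where
    covered : eval α (conjVars (monOf q p j)) ≡ true → eval α (⋁ (map θ (qSetsContaining q p j))) ≡ true
    covered αj =
      let E , bE , ∣E∣≡q , j∈E = block-covers α (eval-clauseForm α C αh) j (trans (sym (eval-conjVars α (monOf q p j))) αj)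
      in evalAny-true⁺ α (∈-map⁺ θ (∈-filter⁺ (λ E → (∣ E ∣ ≟ q) ×-dec (j ∈ˢ? E)) (∈-subsets E) (∣E∣≡q , j∈E)))
                       (trans (eval-θ α E) bE)

  record Admissible (φ : Form n) : Set where
    constructor admissible
    field
      uses-only : UsesOnly Vc φ
      entailed : ∀ α → eval α h ≡ true → eval α φ ≡ true
      small : Within 𝕫 0 φ

  admissible-implication : ∀ E j → j ∈ E → Admissible (implication E j)
  admissible-implication E j j∈E =
    admissible (usesOnly-θ E , usesOnly-monomial j , _) (valid-implication E j j∈E) (within-implication E j)

  admissible-exclusion : ∀ E F → E ≢ F → Nonempty (E ∩ F) → Admissible (exclusion E F)
  admissible-exclusion E F E≢F meet =
    admissible (usesOnly-θ E , usesOnly-θ F , _) (valid-exclusion E F E≢F meet) (within-exclusion E F)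

  admissible-coverage : ∀ j → Admissible (coverage j)
  admissible-coverage j =
    admissible (usesOnly-monomial j , allUseOnly (map θ Es) usesOnly-θs , _) (valid-coverage j) (within-coverage j)
    where
    Es = qSetsContaining q p j
    usesOnly-θs : ∀ {B} → B ∈ₗ map θ Es → UsesOnly Vc B
    usesOnly-θs B∈ = let E , _ , B≡θE = ∈-map⁻ θ B∈ in subst (UsesOnly Vc) (sym B≡θE) (usesOnly-θ E)

  statements-admissible : ∀ {φ} → φ ∈ₗ statements → Admissible φ
  statements-admissible {φ} φ∈ =
    [ from-implication , [ from-exclusion , from-coverage ]′ ∘ ∈-++⁻ exclusions ]′ (∈-++⁻ implications φ∈)
    where
    from-implication : φ ∈ₗ implications → Admissible φ
    from-implication φ∈₁ =
      let E , _ , φ∈E = find (∈-concatMap⁻ implicationsOf {xs = qSets} φ∈₁)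
          j , j∈ , φ≡ = ∈-map⁻ (implication E) φ∈E
      in subst Admissible (sym φ≡) (admissible-implication E j (proj₂ (∈-filter⁻ (_∈ˢ? E) {xs = allFin m} j∈)))
    from-exclusion : φ ∈ₗ exclusions → Admissible φ
    from-exclusion φ∈₂ =
      let E , _ , φ∈E = find (∈-concatMap⁻ exclusionsOf {xs = qSets} φ∈₂)
          F , F∈ , φ≡ = ∈-map⁻ (exclusion E) φ∈E
          E≢F , meet = proj₂ (∈-filter⁻ (overlapping? E) {xs = qSets} F∈)
      in subst Admissible (sym φ≡) (admissible-exclusion E F E≢F meet)
    from-coverage : φ ∈ₗ coverages → Admissible φ
    from-coverage φ∈₃ = let j , _ , φ≡ = ∈-map⁻ coverage φ∈₃ in subst Admissible (sym φ≡) (admissible-coverage j)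

  ∈-qSets : ∀ {E} → ∣ E ∣ ≡ q → E ∈ₗ qSets
  ∈-qSets {E} ∣E∣≡q = ∈-filter⁺ (λ E → ∣ E ∣ ≟ q) (∈-subsets E) ∣E∣≡q

  implication∈ : ∀ E → ∣ E ∣ ≡ q → ∀ j → j ∈ E → implication E j ∈ₗ statements
  implication∈ E ∣E∣≡q j j∈E =
    ∈-++⁺ˡ (∈-concatMap⁺ implicationsOf {xs = qSets}
      (lose (∈-qSets ∣E∣≡q) (∈-map⁺ (implication E) (∈-filter⁺ (_∈ˢ? E) (∈-allFin j) j∈E))))

  exclusion∈ : ∀ E F → ∣ E ∣ ≡ q → ∣ F ∣ ≡ q → E ≢ F → Nonempty (E ∩ F) → exclusion E F ∈ₗ statements
  exclusion∈ E F ∣E∣≡q ∣F∣≡q E≢F meet =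
    ∈-++⁺ʳ implications (∈-++⁺ˡ (∈-concatMap⁺ exclusionsOf {xs = qSets}
      (lose (∈-qSets ∣E∣≡q) (∈-map⁺ (exclusion E) (∈-filter⁺ (overlapping? E) (∈-qSets ∣F∣≡q) (E≢F , meet))))))

  coverage∈ : ∀ j → coverage j ∈ₗ statements
  coverage∈ j = ∈-++⁺ʳ implications (∈-++⁺ʳ exclusions (∈-map⁺ coverage (∈-allFin j)))

  Nb : ℕ
  Nb = 2 ^ length Vc * (20 * Z + 8)

  reduction : ∃ λ ls → Derivation H ls × PartitionDerived q p θ ls × length ls ≤ length statements * Nb ×
                       All (λ B → size B ≤ K) ls × All (λ B → depth B ≤ Dp) ls
  reduction =
    let ls , d , ⊆ls , len , sz , dp = proveAll statements prove
    in ls , d ,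
       ((λ E ∣E∣≡q j j∈E → ⊆ls (implication∈ E ∣E∣≡q j j∈E)) ,
        (λ E F ∣E∣≡q ∣F∣≡q E≢F meet → ⊆ls (exclusion∈ E F ∣E∣≡q ∣F∣≡q E≢F meet)) ,
        (λ j → ⊆ls (coverage∈ j))) ,
       len , sz , dp
    where
    prove : ∀ {φ} → φ ∈ₗ statements → Line Nb φ
    prove φ∈ =
      let admissible uφ h⊨φ wφ = statements-admissible φ∈
      in Complete.complete h _ C∈H (usesOnly-clauseForm C) uφ h⊨φ within-h wφ

module PowerBounds (X : ℕ) (2≤X : 2 ≤ X) where

  open import Data.Nat using (zero; suc; _+_; _*_; _^_; _≤_; z≤n; s≤s; >-nonZero)
  open import Data.Nat.Properties
  open import Relation.Binary.PropositionalEquality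

  n≤2^n : ∀ k → k ≤ 2 ^ k
  n≤2^n zero = z≤n
  n≤2^n (suc k) = +-mono-≤ (≤-trans (s≤s z≤n) (^-monoʳ-≤ 2 {0} {k} z≤n)) (≤-trans (n≤2^n k) (m≤m+n (2 ^ k) 0))

  record _≤X^_ (x e : ℕ) : Set where
    constructor bound
    field
      get : x ≤ X ^ e

  instance
    X-nonZero : NonZero X
    X-nonZero = >-nonZero (≤-trans (s≤s z≤n) 2≤X)

  X^-mono : ∀ {a b} → a ≤ b → X ^ a ≤ X ^ b
  X^-mono = ^-monoʳ-≤ X

  raise : ∀ {a b x} → a ≤ b → x ≤X^ a → x ≤X^ b
  raise a≤b (bound x≤) = bound (≤-trans x≤ (X^-mono a≤b))

  below : ∀ {a x y} → x ≤ y → y ≤X^ a → x ≤X^ a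
  below x≤y (bound y≤) = bound (≤-trans x≤y y≤)

  ≤X : ∀ {x} → x ≤ X → x ≤X^ 1
  ≤X {x} x≤X = bound (≤-trans x≤X (≤-reflexive (sym (*-identityʳ X))))

  add : ∀ {a x y} → x ≤X^ a → y ≤X^ a → (x + y) ≤X^ suc a
  add {a} (bound x≤) (bound y≤) =
    bound (≤-trans (+-mono-≤ x≤ y≤) (≤-trans (≤-reflexive (cong (X ^ a +_) (sym (+-identityʳ (X ^ a))))) (*-monoˡ-≤ (X ^ a) 2≤X)))

  mul : ∀ {a b x y} → x ≤X^ a → y ≤X^ b → (x * y) ≤X^ (a + b)
  mul {a} {b} (bound x≤) (bound y≤) = bound (≤-trans (*-mono-≤ x≤ y≤) (≤-reflexive (sym (^-distribˡ-+-* X a b))))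

  pow : ∀ {a x} k → x ≤X^ a → (x ^ k) ≤X^ (a * k)
  pow {a} k (bound x≤) = bound (≤-trans (^-monoˡ-≤ k x≤) (≤-reflexive (^-*-assoc X a k)))

open import Data.Nat using (_+_; _*_; _^_)

-- In powers of X = 2^(w+q+5), the lines for one clause have total size at most X ^ exponent q.
exponent constant : ℕ → ℕ
exponent q = 12 * q + 22
constant q = 2 ^ ((q + 5) * exponent q) + exponent q

module ClauseCost (q : ℕ) .{{_ : NonZero q}} (2≤q : 2 ≤ q) (w : ℕ) {n : ℕ} (H : List (Form n)) (C : Clause n)
                  (C∈H : clauseForm C ∈ₗ H) (C≤w : length C ≤ w) where

  open import Data.Nat using (suc; _+_; _*_; _^_; _≤_; z≤n; s≤s)
  open import Data.Nat.Properties
  open import Data.Nat.Tactic.RingSolver using (solve-∀)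
  open import Data.List using (_++_; length; filter; allFin)
  open import Data.List.Properties using (length-++; length-map; length-filter; length-tabulate)
  open import Data.List.Relation.Unary.All using (All)
  open import Data.Product using (∃; _×_; _,_)
  open import Relation.Binary.PropositionalEquality
  open Semantics using (sizes≤length*)
  open ClauseReduction q H C C∈H
  open Partition q C using (m)
  open Support using (clauseVars; Mf-length; tr-length)
  open Completeness H (clauseVars C) Z 7 using (K)
  open FormulaSizes using (count-subsets)
  open ListFacts using (length-concatMap≤)

  length-statements : length statements ≤ Qn * m + Qn * Qn + m
  length-statements = begin
    length (implications ++ exclusions ++ coverages)                    ≡⟨ length-++ implications ⟩
    length implications + length (exclusions ++ coverages)              ≡⟨ cong (length implications +_) (length-++ exclusions) ⟩
    length implications + (length exclusions + length coverages)       ≤⟨ +-mono-≤ implications≤ (+-mono-≤ exclusions≤ coverages≤) ⟩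
    Qn * m + (Qn * Qn + m)                                              ≡⟨ +-assoc (Qn * m) (Qn * Qn) m ⟨
    Qn * m + Qn * Qn + m ∎
    where
    open ≤-Reasoning
    allFin-length : length (allFin m) ≡ m
    allFin-length = length-tabulate (λ i → i)
    implications≤ = length-concatMap≤ implicationsOf qSets m
      (λ E → ≤-trans (≤-reflexive (length-map _ (filter _ (allFin m)))) (≤-trans (length-filter _ (allFin m)) (≤-reflexive allFin-length)))
    exclusions≤ = length-concatMap≤ exclusionsOf qSets Qn
      (λ E → ≤-trans (≤-reflexive (length-map _ (filter _ qSets))) (length-filter _ qSets))
    coverages≤ = ≤-reflexive (trans (length-map coverage (allFin m)) allFin-length)

  X : ℕ
  X = 2 ^ (w + q + 5)

  7≤exponent : 7 ≤ w + q + 5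
  7≤exponent = +-monoˡ-≤ 5 (≤-trans 2≤q (m≤n+m q w))

  open PowerBounds X (^-monoʳ-≤ 2 (≤-trans (s≤s z≤n) 7≤exponent))

  const : ∀ {k} → k ≤ 128 → k ≤X^ 1
  const k≤ = ≤X (≤-trans k≤ (^-monoʳ-≤ 2 7≤exponent))

  2^ℓ≤ : (2 ^ ℓ) ≤X^ 1
  2^ℓ≤ = ≤X (^-monoʳ-≤ 2 (≤-trans C≤w (≤-trans (m≤m+n w q) (m≤m+n (w + q) 5))))

  ℓ≤ : ℓ ≤X^ 1
  ℓ≤ = below (n≤2^n ℓ) 2^ℓ≤

  q≤ : q ≤X^ 1
  q≤ = ≤X (≤-trans (n≤2^n q) (^-monoʳ-≤ 2 (≤-trans (m≤n+m q w) (m≤m+n (w + q) 5))))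

  m≤ : m ≤X^ 2
  m≤ = below (≤-trans (Mf-length q (tr C)) (*-monoʳ-≤ q (tr-length C))) (mul q≤ 2^ℓ≤)

  Qn≤ : Qn ≤X^ (3 * q)
  Qn≤ = below (count-subsets m q) (pow q (add (raise (s≤s z≤n) (const (s≤s z≤n))) m≤))

  Z≤ : Z ≤X^ (5 + suc (3 * q))
  Z≤ = mul Sb≤ (add Qn≤ (raise 1≤3q (const (s≤s (s≤s (s≤s z≤n))))))
    where
    1≤3q : 1 ≤ 3 * q
    1≤3q = ≤-trans (≤-trans (s≤s z≤n) 2≤q) (m≤m+n q _)
    R≤ : R ≤X^ 4
    R≤ = mul (add (raise (s≤s z≤n) (const (s≤s (s≤s z≤n)))) (mul (const (s≤s (s≤s (s≤s z≤n)))) ℓ≤)) 2^ℓ≤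
    Sb≤ : Sb ≤X^ 5
    Sb≤ = add (raise (s≤s z≤n) (const (s≤s (s≤s (s≤s z≤n))))) R≤

  z : ℕ
  z = 5 + suc (3 * q)

  2^Vc≤ : (2 ^ length Vc) ≤X^ 1
  2^Vc≤ = subst (λ l → (2 ^ l) ≤X^ 1) (sym length-Vc) 2^ℓ≤

  Nb≤ : Nb ≤X^ (1 + suc (1 + z))
  Nb≤ = mul 2^Vc≤ (add (mul (const (m≤m+n 20 108)) Z≤) (raise (s≤s z≤n) (const (m≤m+n 8 120))))

  K≤ : K ≤X^ suc (suc (1 + z))
  K≤ = add (add (mul (const (m≤m+n 5 123)) Z≤)
                (raise (s≤s (s≤s (s≤s z≤n))) (mul (const (m≤m+n 3 125)) (mul (const (m≤m+n 2 126)) (subst (_≤X^ 1) (sym length-Vc) ℓ≤)))))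
           (raise (n≤1+n _) (raise (s≤s z≤n) (const (m≤m+n 20 108))))

  t : ℕ
  t = 3 * q + 3 * q + 2

  statements≤ : (Qn * m + Qn * Qn + m) ≤X^ suc (suc t)
  statements≤ = add (add (raise (+-monoˡ-≤ 2 (m≤m+n (3 * q) (3 * q))) (mul Qn≤ m≤)) (raise (m≤m+n _ 2) (mul Qn≤ Qn≤)))
                    (raise (≤-trans (m≤n+m 2 (3 * q + 3 * q)) (n≤1+n _)) m≤)

  total≤ : ((Qn * m + Qn * Qn + m) * Nb * K) ≤X^ exponent q
  total≤ = raise (≤-reflexive (count q)) (mul (mul statements≤ Nb≤) K≤)
    where
    count : ∀ q → suc (suc (3 * q + 3 * q + 2)) + (1 + suc (1 + (5 + suc (3 * q)))) + suc (suc (1 + (5 + suc (3 * q)))) ≡ 12 * q + 22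
    count = solve-∀

  X^exponent≤ : (2 ^ (w + q + 5)) ^ exponent q ≤ constant q * 2 ^ (constant q * w)
  X^exponent≤ = begin
    (2 ^ (w + q + 5)) ^ e                 ≡⟨ ^-*-assoc 2 (w + q + 5) e ⟩
    2 ^ ((w + q + 5) * e)                 ≡⟨ cong (2 ^_) (split w q e) ⟩
    2 ^ ((q + 5) * e + w * e)             ≡⟨ ^-distribˡ-+-* 2 ((q + 5) * e) (w * e) ⟩
    2 ^ ((q + 5) * e) * 2 ^ (w * e)        ≤⟨ *-mono-≤ (m≤m+n (2 ^ ((q + 5) * e)) e) (^-monoʳ-≤ 2 (≤-trans (≤-reflexive (*-comm w e)) (*-monoˡ-≤ w (m≤n+m e (2 ^ ((q + 5) * e)))))) ⟩
    constant q * 2 ^ (constant q * w)      ∎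
    where
    open ≤-Reasoning
    e = exponent q
    split : ∀ w q e → (w + q + 5) * e ≡ (q + 5) * e + w * e
    split = solve-∀

  cost-bound : (Qn * m + Qn * Qn + m) * Nb * K ≤ constant q * 2 ^ (constant q * w)
  cost-bound = ≤-trans (_≤X^_.get total≤) X^exponent≤

  clauseCost : ∃ λ ls → Derivation H ls × PartitionDerived q (tr C) (Partition.θ q C) ls ×
                        sizes ls ≤ constant q * 2 ^ (constant q * w) × All (λ B → depth B ≤ 10) ls
  clauseCost =
    let ls , d , pd , len , sz , dp = reduction
    in ls , d , pd , ≤-trans (sizes≤length* ls sz) (≤-trans (*-monoˡ-≤ K (≤-trans len (*-monoˡ-≤ Nb length-statements))) cost-bound) , dp

module Assembly (q : ℕ) .{{_ : NonZero q}} (2≤q : 2 ≤ q) (w : ℕ) {n : ℕ} (F : CNF n) where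

  open import Data.Nat using (_*_; _^_; z≤n)
  open import Data.Nat.Properties
  open import Data.Nat.Tactic.RingSolver using (solve-∀)
  open import Data.Fin.Subset using (Subset)
  open import Data.List using ([]; _∷_; _++_; map)
  open import Data.List.Relation.Unary.All using (All; []; _∷_)
  open import Data.List.Relation.Unary.All.Properties using (++⁺)
  open import Data.List.Relation.Unary.Any using (here; there)
  open import Data.List.Membership.Propositional.Properties using (∈-++⁺ˡ; ∈-++⁺ʳ; ∈-map⁺)
  open import Data.List.Relation.Binary.Subset.Propositional using (_⊆_)
  open import Data.Product using (∃; Σ; _×_; _,_; proj₁; proj₂)
  open import Relation.Binary.PropositionalEquality
  open import Function using (_∘_; case_of_)
  open Semantics using (sizes-++)


  H : List (Form n)
  H = map clauseForm F

  open Derivations H using (_++ᴰ_)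

  cost : ℕ
  cost = constant q * 2 ^ (constant q * w)

  θ-of : (C : Clause n) → Subset (sizeM q (tr C)) → Form n
  θ-of C = Partition.θ q C

  clauseCost : ∀ (C : Clause n) → C ∈ₗ F → length C ≤ w →
               ∃ λ ls → Derivation H ls × PartitionDerived q (tr C) (θ-of C) ls × sizes ls ≤ cost × All (λ B → depth B ≤ 10) ls
  clauseCost C C∈F C≤w = ClauseCost.clauseCost q 2≤q w H C (∈-map⁺ clauseForm C∈F) C≤w

  PartitionDerived-mono : ∀ (p : Poly n) θ {ls ls'} → ls ⊆ ls' → PartitionDerived q p θ ls → PartitionDerived q p θ ls'
  PartitionDerived-mono p θ ls⊆ (implications , exclusions , coverages) =
    (λ E ∣E∣ j j∈E → ls⊆ (implications E ∣E∣ j j∈E)) , (λ E F ∣E∣ ∣F∣ E≢F meet → ls⊆ (exclusions E F ∣E∣ ∣F∣ E≢F meet)) , (λ j → ls⊆ (coverages j))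

  partitions-++ : ∀ {C G ls₁ ls₂} → PartitionDerived q (tr C) (θ-of C) ls₁ →
                  (∀ {C'} → C' ∈ₗ G → PartitionDerived q (tr C') (θ-of C') ls₂) →
                  ∀ {C'} → C' ∈ₗ C ∷ G → PartitionDerived q (tr C') (θ-of C') (ls₁ ++ ls₂)
  partitions-++ {C} pd₁ pds₂ (here refl) = PartitionDerived-mono (tr C) (θ-of C) ∈-++⁺ˡ pd₁
  partitions-++ {ls₁ = ls₁} pd₁ pds₂ {C'} (there C'∈G) = PartitionDerived-mono (tr C') (θ-of C') (∈-++⁺ʳ ls₁) (pds₂ C'∈G)

  Collected : CNF n → Set
  Collected G = ∃ λ ls → Derivation H ls × (∀ {C} → C ∈ₗ G → PartitionDerived q (tr C) (θ-of C) ls) ×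
                         sizes ls ≤ length G * cost × All (λ B → depth B ≤ 10) ls

  collect : ∀ G → (∀ {C} → C ∈ₗ G → C ∈ₗ F) → All (λ C → length C ≤ w) G → Collected G
  collect [] _ _ = [] , [] , (λ ()) , z≤n , []
  collect (C ∷ G) G⊆F (C≤w ∷ G≤w) =
    let ls₁ , d₁ , pd₁ , s₁ , dp₁ = clauseCost C (G⊆F (here refl)) C≤w
        ls₂ , d₂ , pds₂ , s₂ , dp₂ = collect G (G⊆F ∘ there) G≤w
    in ls₁ ++ ls₂ , d₁ ++ᴰ d₂ ,
       partitions-++ pd₁ pds₂ ,
       ≤-trans (≤-reflexive (sizes-++ ls₁ ls₂)) (+-mono-≤ s₁ s₂) ,
       ++⁺ dp₁ dp₂

  -- The family of partition statements in ReducesTo is not nameable outside Defs, so the reduction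
  -- is built clause by clause through ReducesTo itself, recording that the lines stay ls.
  package : ∀ {T} ls → Derivation H ls → sizes ls ≤ T → All (λ B → depth B ≤ 10) ls → ∀ G →
            (∀ {C} → C ∈ₗ G → PartitionDerived q (tr C) (θ-of C) ls) →
            Σ (ReducesTo H (trCNF G) q 10 T) λ r → proj₁ (proj₂ r) ≡ ls
  package ls d s dp [] _ = ([] , ls , d , s , dp , _) , refl
  package ls d s dp (C ∷ G) pds = case package ls d s dp G (pds ∘ there) of λ where
    ((β , .ls , _ , _ , _ , partitions) , refl) → (θ-of C ∷ β , ls , d , s , dp , pds (here refl) , partitions) , refl

  reduces : WidthAtMost w F → ReducesTo H (trCNF F) q 10 (constant q * length F * 2 ^ (constant q * w))
  reduces F≤w =
    let ls , d , pds , s , dp = collect F (λ C∈F → C∈F) F≤w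
    in proj₁ (package ls d (≤-trans s (≤-reflexive (rearrange (length F) (constant q) (2 ^ (constant q * w))))) dp F pds)
    where
    rearrange : ∀ l c x → l * (c * x) ≡ c * l * x
    rearrange = solve-∀

open import Data.Nat using (ℕ; _*_; _^_; _≤_; NonZero)
open import Data.List using (length; map)
open import Data.Product using (Σ; _,_)

mainTheorem3 : (q : ℕ) .{{_ : NonZero q}} → 2 ≤ q →
    Σ ℕ λ d → Σ ℕ λ c →
      ∀ (n : ℕ) (F : CNF n) (w : ℕ) → WidthAtMost w F → Unsatisfiable F →
        ReducesTo (map clauseForm F) (trCNF F) q d (c * length F * 2 ^ (c * w))
-- The reduction does not use the unsatisfiability of F.
mainTheorem3 q 2≤q = 10 , constant q , λ n F w F≤w _ → Assembly.reduces q 2≤q w F F≤w
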